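{- Let $t \ge 2$ be an integer and let \[ U_t(x) = 2x^{4t-1} + x^{2t+4} - 2x^{2t+1} + 2x^{2t-1} - x^{2t-4} - 2x,\qquad W_t(x) = 2x^{4t-1} - x^{2t+4} - 2x^{2t+1} + 2x^{2t-1} + x^{2t-4} - 2x. \] If $b \in \mathbb{N}$ with $4 \mid b$ is such that $\Phi_b(x)$ divides $U_t(x)$ or $W_t(x)$, then $b = 4$ or $b = 8$.
   Context: $\Phi_b(x)$ denotes the $b$-th cyclotomic polynomial, $\Phi_b(x) = \prod_\zeta (x-\zeta)$ over the primitive $b$-th roots of unity $\zeta$. -}

module Defs where

open import Data.Nat as ℕ using (ℕ; zero; suc; _∸_)
open import Data.Nat.Divisibility using (_∣?_)
open import Data.Integer as ℤ using (ℤ; +_; _-_; -_; _*_)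
open import Data.List using (List; []; _∷_; _++_; map; foldr; reverse; length; filter; replicate)
open import Data.Bool using (if_then_else_)
open import Relation.Nullary.Decidable using (⌊_⌋)
open import Relation.Binary.PropositionalEquality using (_≡_)
open import Data.Product using (∃)

-- Polynomials over ℤ as coefficient lists, lowest degree first.
Poly : Set
Poly = List ℤ

infixl 6 _+P_
infixl 7 _*P_

_+P_ : Poly → Poly → Poly
[]      +P q       = q
(a ∷ p) +P []      = a ∷ p
(a ∷ p) +P (b ∷ q) = (a ℤ.+ b) ∷ (p +P q)

scaleP : ℤ → Poly → Poly
scaleP c = map (c *_)

_*P_ : Poly → Poly → Poly
[]      *P q = []
(a ∷ p) *P q = scaleP a q +P ((+ 0) ∷ (p *P q))

consN : ℤ → Poly → Poly
consN a [] = if ⌊ a ℤ.≟ + 0 ⌋ then [] else (a ∷ [])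
consN a (b ∷ r) = a ∷ b ∷ r

normP : Poly → Poly
normP [] = []
normP (a ∷ p) = consN a (normP p)

infix 4 _≈P_
_≈P_ : Poly → Poly → Set
p ≈P q = normP p ≡ normP q

infix 4 _∣P_
_∣P_ : Poly → Poly → Set
d ∣P p = ∃ λ q → d *P q ≈P p

mono : ℤ → ℕ → Poly
mono c k = replicate k (+ 0) ++ (c ∷ [])

prodP : List Poly → Poly
prodP = foldr _*P_ (+ 1 ∷ [])

private
  subL : ℤ → List ℤ → List ℤ → List ℤ
  subL c []       r        = r
  subL c (e ∷ es) []       = []
  subL c (e ∷ es) (x ∷ xs) = (x - c * e) ∷ subL c es xs

  go : List ℤ → ℕ → List ℤ → List ℤ
  go rd' zero    r       = []
  go rd' (suc k) []      = []
  go rd' (suc k) (c ∷ r) = c ∷ go rd' k (subL c rd' r)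

quotMonic : Poly → Poly → Poly
quotMonic p d with reverse (normP d)
... | []       = []
... | _ ∷ rd'  = let rp = reverse (normP p) in
                 reverse (go rd' (suc (length rp ∸ suc (length rd'))) rp)

lookupD : List Poly → ℕ → Poly
lookupD []       _       = []
lookupD (x ∷ xs) zero    = x
lookupD (x ∷ xs) (suc n) = lookupD xs n

-- [1, 2, ..., n-1]
range1 : ℕ → List ℕ
range1 zero = []
range1 (suc zero) = []
range1 (suc (suc n)) = range1 (suc n) ++ (suc n ∷ [])

properDivisors : ℕ → List ℕ
properDivisors m = filter (λ d → d ∣? m) (range1 m)

xnm1 : ℕ → Poly
xnm1 n = mono (+ 1) n +P mono (- + 1) 0

-- cycs n = [Φ₁, …, Φₙ], via  x^m - 1 = ∏_{d ∣ m} Φ_d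
cycs : ℕ → List Poly
cycs zero = []
cycs (suc n) = let prev = cycs n in
  prev ++ (quotMonic (xnm1 (suc n))
                     (prodP (map (λ d → lookupD prev (d ∸ 1)) (properDivisors (suc n)))) ∷ [])

-- the b-th cyclotomic polynomial (b ≥ 1); Φ 0 is a junk value
Φ : ℕ → Poly
Φ n = lookupD (cycs n) (n ∸ 1)

U : ℕ → Poly
U t = mono (+ 2) (4 ℕ.* t ∸ 1) +P mono (+ 1) (2 ℕ.* t ℕ.+ 4) +P mono (- + 2) (2 ℕ.* t ℕ.+ 1)
   +P mono (+ 2) (2 ℕ.* t ∸ 1) +P mono (- + 1) (2 ℕ.* t ∸ 4) +P mono (- + 2) 1

W : ℕ → Poly
W t = mono (+ 2) (4 ℕ.* t ∸ 1) +P mono (- + 1) (2 ℕ.* t ℕ.+ 4) +P mono (- + 2) (2 ℕ.* t ℕ.+ 1)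
   +P mono (+ 2) (2 ℕ.* t ∸ 1) +P mono (+ 1) (2 ℕ.* t ∸ 4) +P mono (- + 2) 1

{-# OPTIONS --safe #-}
-- Polynomials are handled through their values on ℤ, which determine the coefficients, and
-- divisibility and coprimality are taken over ℚ with the denominators cleared.  When 4 ∣ b,
-- every Φ c(−x) with c a proper divisor of b divides some x^(2k) − 1 with 2k a proper divisor
-- of b, so Φ b ∣ xᵇ − 1 = Φ b(−x) · ∏ Φ c(−x) yields Φ b ∣ Φ b(−x).  Hence Φ b ∣ U implies
-- Φ b ∣ U(x) + U(−x) = ±2·x^(2t−4)·(x⁸ − 1), and since Φ b(0) ≠ 0, Φ b ∣ x⁸ − 1, forcing b ∣ 8.
-- For Φ n defined as the quotient of xⁿ − 1 by ∏_{d ∣ n, d < n} Φ d, the facts this needs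
-- (the division is exact and Φ n is monic, the Φ d are pairwise coprime, Φ n has positive
-- degree, and Φ n ∣ xᵐ − 1 ⇒ n ∣ m) follow by strong induction from the squarefreeness of
-- xⁿ − 1 (via x·d/dx) and x^gcd(m,n) − 1 = α·(xᵐ − 1) + β·(xⁿ − 1).

module Submission where

open import Defs
open import Data.Empty using (⊥-elim)
open import Data.Integer as ℤ using (ℤ; +_; -_; _+_; _*_; _-_; _^_; 0ℤ; 1ℤ; ∣_∣)
import Data.Integer.Properties as ℤP
open import Algebra.Properties.AbelianGroup ℤP.+-0-abelianGroup using () renaming (∙-cancelˡ to +-cancelˡ)
open import Data.Integer.Tactic.RingSolver using (solve-∀)
open import Data.List using (List; []; _∷_; _++_; length; reverse; map)
import Data.List.Properties as LP
open import Data.List.Membership.Propositional using (_∈_)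
import Data.List.Membership.Propositional.Properties as MP
open import Data.List.Relation.Unary.All as All using (All; []; _∷_)
import Data.List.Relation.Unary.All.Properties as AllP
open import Data.List.Relation.Unary.AllPairs as AllPairs using (AllPairs; []; _∷_)
import Data.List.Relation.Unary.AllPairs.Properties as AllPairsP
open import Data.List.Relation.Unary.Any using (here; there)
open import Data.Nat as ℕ using (ℕ; zero; suc; _∸_; _≤_; _<_; z≤n; s≤s)
open import Data.Nat.Coprimality using (Coprime; coprime-divisor)
open import Data.Nat.Divisibility as ND using (_∣_; _∣?_; divides)
open import Data.Nat.GCD using (module Bézout; module GCD)
open import Data.Nat.Induction using (<-rec)
open import Data.Nat.ListAction using (product)
open import Data.Nat.Primality using (Prime; prime⇒irreducible; prime⇒nonZero; prime⇒nonTrivial; prime[2]; euclidsLemma)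
open import Data.Nat.Primality.Factorisation using (factorise)
import Data.Nat.Properties as ℕP
import Data.Nat.Tactic.RingSolver as ℕ-Solver
open import Data.Product using (∃; ∃₂; _×_; _,_; proj₁; proj₂)
open import Data.Sum using (_⊎_; inj₁; inj₂; [_,_]′)
open import Relation.Binary.Definitions using (tri<; tri≈; tri>)
open import Relation.Binary.PropositionalEquality
open import Relation.Nullary using (¬_; yes; no; contradiction)

-- Evaluation and coefficients

eval : Poly → ℤ → ℤ
eval []      z = 0ℤ
eval (a ∷ p) z = a + z * eval p z

eval-+P : ∀ p q z → eval (p +P q) z ≡ eval p z + eval q z
eval-+P []      q       z = sym (ℤP.+-identityˡ (eval q z))
eval-+P (a ∷ p) []      z = sym (ℤP.+-identityʳ _)
eval-+P (a ∷ p) (b ∷ q) z rewrite eval-+P p q z = lemma a b z (eval p z) (eval q z)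
  where lemma : ∀ a b z x y → (a + b) + z * (x + y) ≡ (a + z * x) + (b + z * y)
        lemma = solve-∀

eval-scaleP : ∀ c p z → eval (scaleP c p) z ≡ c * eval p z
eval-scaleP c []      z = sym (ℤP.*-zeroʳ c)
eval-scaleP c (a ∷ p) z rewrite eval-scaleP c p z = lemma c a z (eval p z)
  where lemma : ∀ c a z x → c * a + z * (c * x) ≡ c * (a + z * x)
        lemma = solve-∀

eval-*P : ∀ p q z → eval (p *P q) z ≡ eval p z * eval q z
eval-*P []      q z = refl
eval-*P (a ∷ p) q z
  rewrite eval-+P (scaleP a q) (+ 0 ∷ (p *P q)) z | eval-scaleP a q z | eval-*P p q z
  = lemma a z (eval p z) (eval q z)
  where lemma : ∀ a z x y → a * y + (+ 0 + z * (x * y)) ≡ (a + z * x) * y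
        lemma = solve-∀

eval-consN : ∀ a r z → eval (consN a r) z ≡ a + z * eval r z
eval-consN a []      z with a ℤ.≟ + 0
... | yes refl = sym (trans (ℤP.+-identityˡ _) (ℤP.*-zeroʳ z))
... | no _     = refl
eval-consN a (b ∷ r) z = refl

eval-normP : ∀ p z → eval (normP p) z ≡ eval p z
eval-normP []      z = refl
eval-normP (a ∷ p) z rewrite eval-consN a (normP p) z | eval-normP p z = refl

eval-≈P : ∀ {p q} → p ≈P q → eval p ≗ eval q
eval-≈P {p} {q} p≈q z = begin
  eval p z         ≡⟨ sym (eval-normP p z) ⟩
  eval (normP p) z ≡⟨ cong (λ r → eval r z) p≈q ⟩
  eval (normP q) z ≡⟨ eval-normP q z ⟩
  eval q z         ∎
  where open ≡-Reasoning

eval-mono : ∀ c k z → eval (mono c k) z ≡ c * z ^ k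
eval-mono c zero    z = trans (cong (_+_ c) (ℤP.*-zeroʳ z)) (trans (ℤP.+-identityʳ c) (sym (ℤP.*-identityʳ c)))
eval-mono c (suc k) z rewrite eval-mono c k z = lemma c z (z ^ k)
  where lemma : ∀ c z w → + 0 + z * (c * w) ≡ c * (z * w)
        lemma = solve-∀

eval-xnm1 : ∀ n z → eval (xnm1 n) z ≡ z ^ n - 1ℤ
eval-xnm1 n z rewrite eval-+P (mono 1ℤ n) (mono (- 1ℤ) 0) z | eval-mono 1ℤ n z | eval-mono (- 1ℤ) 0 z = lemma (z ^ n)
  where lemma : ∀ w → 1ℤ * w + (- 1ℤ) * 1ℤ ≡ w - 1ℤ
        lemma = solve-∀

eval-++ : ∀ xs ys z → eval (xs ++ ys) z ≡ eval xs z + z ^ length xs * eval ys z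
eval-++ []       ys z = sym (trans (ℤP.+-identityˡ _) (ℤP.*-identityˡ _))
eval-++ (x ∷ xs) ys z rewrite eval-++ xs ys z = lemma x z (eval xs z) (z ^ length xs) (eval ys z)
  where lemma : ∀ x z a w b → x + z * (a + w * b) ≡ x + z * a + z * w * b
        lemma = solve-∀

coeff : Poly → ℕ → ℤ
coeff []      i       = 0ℤ
coeff (a ∷ p) zero    = a
coeff (a ∷ p) (suc i) = coeff p i

constTerm : Poly → ℤ
constTerm p = coeff p 0

divX : Poly → Poly
divX []      = []
divX (a ∷ p) = p

eval-constTerm-divX : ∀ p z → eval p z ≡ constTerm p + z * eval (divX p) z
eval-constTerm-divX []      z = sym (trans (ℤP.+-identityˡ _) (ℤP.*-zeroʳ z))
eval-constTerm-divX (a ∷ p) z = refl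

coeff-suc : ∀ p i → coeff p (suc i) ≡ coeff (divX p) i
coeff-suc []      i = refl
coeff-suc (a ∷ p) i = refl

IsZero : Poly → Set
IsZero p = ∀ i → coeff p i ≡ 0ℤ

infix 4 _≈ᶜ_
_≈ᶜ_ : Poly → Poly → Set
p ≈ᶜ q = ∀ i → coeff p i ≡ coeff q i

private
  ≡0-if-all∣ : ∀ d → (∀ z → z ≢ 0ℤ → ∃ λ w → d ≡ z * w) → d ≡ 0ℤ
  ≡0-if-all∣ d all∣ with ∣ d ∣ ℕ.≟ 0
  ... | yes ∣d∣≡0 = ℤP.∣i∣≡0⇒i≡0 ∣d∣≡0
  ... | no ∣d∣≢0 with all∣ (+ suc ∣ d ∣) (λ ())
  ...   | w , d≡ = contradiction sd∣d (ND.>⇒∤ {{ℕ.≢-nonZero ∣d∣≢0}} ℕP.≤-refl)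
    where
    sd∣d : suc ∣ d ∣ ND.∣ ∣ d ∣
    sd∣d = divides ∣ w ∣ (trans (cong ∣_∣ d≡) (trans (ℤP.abs-* (+ suc ∣ d ∣) w) (ℕP.*-comm (suc ∣ d ∣) ∣ w ∣)))

  AgreeOffZero : Poly → Poly → Set
  AgreeOffZero p q = ∀ z → z ≢ 0ℤ → eval p z ≡ eval q z

  constTerm-unique : ∀ p q → AgreeOffZero p q → constTerm p ≡ constTerm q
  constTerm-unique p q agree = ℤP.i-j≡0⇒i≡j _ _ (≡0-if-all∣ _ λ z z≢0 → _ , difference z (agree z z≢0))
    where
    difference : ∀ z → eval p z ≡ eval q z → constTerm p - constTerm q ≡ z * (eval (divX q) z - eval (divX p) z)
    difference z eq = begin
      a - b                     ≡⟨ lemma₁ a b x z ⟩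
      ((a + z * x) - z * x) - b ≡⟨ cong (λ t → (t - z * x) - b) (trans (sym (eval-constTerm-divX p z))
                                                                     (trans eq (eval-constTerm-divX q z))) ⟩
      ((b + z * y) - z * x) - b ≡⟨ lemma₂ b x y z ⟩
      z * (y - x)               ∎
      where
      open ≡-Reasoning
      a b x y : ℤ
      a = constTerm p
      b = constTerm q
      x = eval (divX p) z
      y = eval (divX q) z
      lemma₁ : ∀ a b x z → a - b ≡ ((a + z * x) - z * x) - b
      lemma₁ = solve-∀
      lemma₂ : ∀ b x y z → ((b + z * y) - z * x) - b ≡ z * (y - x)
      lemma₂ = solve-∀

  divX-agree : ∀ p q → AgreeOffZero p q → AgreeOffZero (divX p) (divX q)
  divX-agree p q agree z z≢0 = ℤP.*-cancelˡ-≡ z _ _ {{ℤ.≢-nonZero z≢0}} (+-cancelˡ (constTerm q) _ _ (begin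
    constTerm q + z * eval (divX p) z ≡⟨ cong (_+ z * eval (divX p) z) (sym (constTerm-unique p q agree)) ⟩
    constTerm p + z * eval (divX p) z ≡⟨ sym (eval-constTerm-divX p z) ⟩
    eval p z                          ≡⟨ agree z z≢0 ⟩
    eval q z                          ≡⟨ eval-constTerm-divX q z ⟩
    constTerm q + z * eval (divX q) z ∎))
    where open ≡-Reasoning

  coeff-unique : ∀ p q → AgreeOffZero p q → p ≈ᶜ q
  coeff-unique p q agree zero    = constTerm-unique p q agree
  coeff-unique p q agree (suc i) =
    trans (coeff-suc p i) (trans (coeff-unique (divX p) (divX q) (divX-agree p q agree) i) (sym (coeff-suc q i)))

eval-injective : ∀ {p q} → eval p ≗ eval q → p ≈ᶜ q
eval-injective {p} {q} p≗q = coeff-unique p q (λ z _ → p≗q z)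

IsZero⇒eval≡0 : ∀ q → IsZero q → ∀ z → eval q z ≡ 0ℤ
IsZero⇒eval≡0 []      q≈0 z = refl
IsZero⇒eval≡0 (a ∷ q) q≈0 z rewrite IsZero⇒eval≡0 q (λ i → q≈0 (suc i)) z | q≈0 0 =
  trans (ℤP.+-identityˡ _) (ℤP.*-zeroʳ z)

≈ᶜ⇒eval : ∀ {p q} → p ≈ᶜ q → eval p ≗ eval q
≈ᶜ⇒eval {[]}    {q}     p≈q z = sym (IsZero⇒eval≡0 q (λ i → sym (p≈q i)) z)
≈ᶜ⇒eval {a ∷ p} {[]}    p≈q z = IsZero⇒eval≡0 (a ∷ p) p≈q z
≈ᶜ⇒eval {a ∷ p} {b ∷ q} p≈q z = cong₂ (λ u v → u + z * v) (p≈q 0) (≈ᶜ⇒eval {p} {q} (λ i → p≈q (suc i)) z)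

coeff-+P : ∀ p q i → coeff (p +P q) i ≡ coeff p i + coeff q i
coeff-+P []      q       i       = sym (ℤP.+-identityˡ _)
coeff-+P (a ∷ p) []      i       = sym (ℤP.+-identityʳ _)
coeff-+P (a ∷ p) (b ∷ q) zero    = refl
coeff-+P (a ∷ p) (b ∷ q) (suc i) = coeff-+P p q i

coeff-scaleP : ∀ c p i → coeff (scaleP c p) i ≡ c * coeff p i
coeff-scaleP c []      i       = sym (ℤP.*-zeroʳ c)
coeff-scaleP c (a ∷ p) zero    = refl
coeff-scaleP c (a ∷ p) (suc i) = coeff-scaleP c p i

coeff-*P-∷ : ∀ a p q i → coeff ((a ∷ p) *P q) i ≡ a * coeff q i + coeff (+ 0 ∷ (p *P q)) i
coeff-*P-∷ a p q i = trans (coeff-+P (scaleP a q) _ i) (cong (_+ coeff (+ 0 ∷ (p *P q)) i) (coeff-scaleP a q i))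

coeff-length : ∀ p i → length p ≤ i → coeff p i ≡ 0ℤ
coeff-length []      i       _          = refl
coeff-length (a ∷ p) (suc i) (s≤s p≤i) = coeff-length p i p≤i

IsZero-*P : ∀ p q → IsZero p → IsZero (p *P q)
IsZero-*P p q p≈0 = eval-injective {p *P q} {[]} λ z →
  trans (eval-*P p q z) (trans (cong (_* eval q z) (IsZero⇒eval≡0 p p≈0 z)) (ℤP.*-zeroˡ (eval q z)))

-- Leading terms

record Leading (p : Poly) (n : ℕ) (c : ℤ) : Set where
  constructor leading
  field
    coeff-degree : coeff p n ≡ c
    lead≢0       : c ≢ 0ℤ
    coeff-above  : ∀ i → n < i → coeff p i ≡ 0ℤ

Monic : Poly → ℕ → Set
Monic p n = Leading p n 1ℤ

Leading⇒¬IsZero : ∀ {p n c} → Leading p n c → ¬ IsZero p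
Leading⇒¬IsZero {n = n} (leading p[n]≡c c≢0 _) p≈0 = c≢0 (trans (sym p[n]≡c) (p≈0 n))

Leading-unique : ∀ {p n m c d} → Leading p n c → Leading p m d → n ≡ m × c ≡ d
Leading-unique {n = n} {m} (leading p[n]≡c c≢0 above₁) (leading p[m]≡d d≢0 above₂) with ℕP.<-cmp n m
... | tri< n<m _ _ = ⊥-elim (d≢0 (trans (sym p[m]≡d) (above₁ m n<m)))
... | tri≈ _ refl _ = refl , trans (sym p[n]≡c) p[m]≡d
... | tri> _ _ m<n = ⊥-elim (c≢0 (trans (sym p[n]≡c) (above₂ n m<n)))

Leading-≈ᶜ : ∀ {p q n c} → p ≈ᶜ q → Leading p n c → Leading q n c
Leading-≈ᶜ {n = n} p≈q (leading p[n]≡c c≢0 above) =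
  leading (trans (sym (p≈q n)) p[n]≡c) c≢0 (λ i n<i → trans (sym (p≈q i)) (above i n<i))

Leading-resp : ∀ {p q n c} → eval p ≗ eval q → Leading p n c → Leading q n c
Leading-resp {p} {q} p≗q = Leading-≈ᶜ (eval-injective {p} {q} p≗q)

Leading-or-zero : ∀ p → IsZero p ⊎ ∃ λ n → ∃ λ c → Leading p n c
Leading-or-zero [] = inj₁ (λ _ → refl)
Leading-or-zero (a ∷ p) with Leading-or-zero p
... | inj₂ (n , c , leading p[n]≡c c≢0 above) = inj₂ (suc n , c , leading p[n]≡c c≢0 above′)
  where above′ : ∀ i → suc n < i → coeff (a ∷ p) i ≡ 0ℤ
        above′ (suc i) (s≤s n<i) = above i n<i
... | inj₁ p≈0 with a ℤ.≟ 0ℤ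
...   | yes a≡0 = inj₁ λ { zero → a≡0 ; (suc i) → p≈0 i }
...   | no  a≢0 = inj₂ (0 , a , leading refl a≢0 λ { (suc i) _ → p≈0 i })

Leading-const : ∀ {c} → c ≢ 0ℤ → Leading (c ∷ []) 0 c
Leading-const c≢0 = leading refl c≢0 λ { (suc i) _ → refl }

Leading-mono : ∀ {c} k → c ≢ 0ℤ → Leading (mono c k) k c
Leading-mono zero    c≢0 = Leading-const c≢0
Leading-mono (suc k) c≢0 with Leading-mono k c≢0
... | leading p[k]≡c _ above = leading p[k]≡c c≢0 λ { (suc i) (s≤s k<i) → above i k<i }

Leading-+P-lower : ∀ {p q n c} → Leading p n c → (∀ i → n ≤ i → coeff q i ≡ 0ℤ) → Leading (p +P q) n c
Leading-+P-lower {p} {q} {n} (leading p[n]≡c c≢0 above) q-low = leading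
  (trans (coeff-+P p q n) (trans (cong₂ _+_ p[n]≡c (q-low n ℕP.≤-refl)) (ℤP.+-identityʳ _)))
  c≢0
  (λ i n<i → trans (coeff-+P p q i) (cong₂ _+_ (above i n<i) (q-low i (ℕP.<⇒≤ n<i))))

private
  Leading-scale : ∀ {q r m b a} → a ≢ 0ℤ → (∀ i → coeff r i ≡ a * coeff q i) → Leading q m b → Leading r m (a * b)
  Leading-scale {a = a} a≢0 r≡aq (leading q[m]≡b b≢0 above) = leading
    (trans (r≡aq _) (cong (a *_) q[m]≡b))
    (λ ab≡0 → [ a≢0 , b≢0 ]′ (ℤP.i*j≡0⇒i≡0∨j≡0 a ab≡0))
    (λ i m<i → trans (r≡aq i) (trans (cong (a *_) (above i m<i)) (ℤP.*-zeroʳ a)))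

  Leading-shift : ∀ {r s n c} → (∀ i → n ≤ i → coeff s (suc i) ≡ coeff r i) → Leading r n c → Leading s (suc n) c
  Leading-shift {n = n} s≡r (leading r[n]≡c c≢0 above) = leading
    (trans (s≡r n ℕP.≤-refl) r[n]≡c) c≢0 λ { (suc i) (s≤s n<i) → trans (s≡r i (ℕP.<⇒≤ n<i)) (above i n<i) }

Leading-scaleP : ∀ {q m a b} → a ≢ 0ℤ → Leading q m b → Leading (scaleP a q) m (a * b)
Leading-scaleP {q} {a = a} a≢0 = Leading-scale a≢0 (coeff-scaleP a q)

Leading-*P : ∀ {p q n m a b} → Leading p n a → Leading q m b → Leading (p *P q) (n ℕ.+ m) (a * b)
Leading-*P {[]} lp _ = ⊥-elim (Leading⇒¬IsZero lp (λ _ → refl))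
Leading-*P {a₀ ∷ p} {q} {zero} {a = a} (leading a₀≡a a≢0 above) lq = Leading-scale a≢0 coeff-≡ lq
  where
  coeff-≡ : ∀ i → coeff ((a₀ ∷ p) *P q) i ≡ a * coeff q i
  coeff-≡ i = begin
    coeff ((a₀ ∷ p) *P q) i                         ≡⟨ coeff-*P-∷ a₀ p q i ⟩
    a₀ * coeff q i + coeff (+ 0 ∷ (p *P q)) i      ≡⟨ cong₂ (λ u v → u * coeff q i + v) a₀≡a (shifted-zero i) ⟩
    a * coeff q i + 0ℤ                             ≡⟨ ℤP.+-identityʳ _ ⟩
    a * coeff q i                                  ∎
    where
    open ≡-Reasoning
    shifted-zero : ∀ i → coeff (+ 0 ∷ (p *P q)) i ≡ 0ℤ
    shifted-zero zero    = refl
    shifted-zero (suc i) = IsZero-*P p q (λ j → above (suc j) (s≤s z≤n)) i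
Leading-*P {a₀ ∷ p} {q} {suc n} {m} (leading p[n]≡a a≢0 above) lq@(leading _ _ q-above) =
  Leading-shift coeff-≡ (Leading-*P {p} (leading p[n]≡a a≢0 λ i n<i → above (suc i) (s≤s n<i)) lq)
  where
  coeff-≡ : ∀ i → n ℕ.+ m ≤ i → coeff ((a₀ ∷ p) *P q) (suc i) ≡ coeff (p *P q) i
  coeff-≡ i n+m≤i = begin
    coeff ((a₀ ∷ p) *P q) (suc i)             ≡⟨ coeff-*P-∷ a₀ p q (suc i) ⟩
    a₀ * coeff q (suc i) + coeff (p *P q) i   ≡⟨ cong (λ t → a₀ * t + coeff (p *P q) i)
                                                     (q-above (suc i) (s≤s (ℕP.≤-trans (ℕP.m≤n+m m n) n+m≤i))) ⟩
    a₀ * 0ℤ + coeff (p *P q) i                ≡⟨ cong (_+ coeff (p *P q) i) (ℤP.*-zeroʳ a₀) ⟩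
    0ℤ + coeff (p *P q) i                     ≡⟨ ℤP.+-identityˡ _ ⟩
    coeff (p *P q) i                          ∎
    where open ≡-Reasoning

Monic-xnm1 : ∀ n → Monic (xnm1 (suc n)) (suc n)
Monic-xnm1 n = Leading-+P-lower {q = mono (- 1ℤ) 0} (Leading-mono (suc n) (λ ())) λ { (suc i) _ → refl }

Monic-prodP : ∀ L → All (λ l → ∃ (Monic l)) L → ∃ (Monic (prodP L))
Monic-prodP []      []                   = 0 , Leading-const (λ ())
Monic-prodP (l ∷ L) ((m , monic) ∷ monics) with Monic-prodP L monics
... | m′ , monic′ = m ℕ.+ m′ , Leading-*P monic monic′

Monic-cofactor : ∀ {p q r m n} → Monic q m → Monic r n → (∀ z → eval p z * eval q z ≡ eval r z) → ∃ (Monic p)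
Monic-cofactor {p} {q} {r} monic-q monic-r pq≡r with Leading-or-zero p
... | inj₁ p≈0 = ⊥-elim (Leading⇒¬IsZero monic-r λ i →
  trans (sym (eval-injective {p *P q} {r} (λ z → trans (eval-*P p q z) (pq≡r z)) i)) (IsZero-*P p q p≈0 i))
... | inj₂ (j , c , lp) = j , subst (Leading p j) c≡1 lp
  where
  c≡1 : c ≡ 1ℤ
  c≡1 = trans (sym (ℤP.*-identityʳ c)) (proj₂ (Leading-unique
          (Leading-resp {p *P q} {r} (λ z → trans (eval-*P p q z) (pq≡r z)) (Leading-*P lp monic-q)) monic-r))

normP-IsZero : ∀ p → IsZero p → normP p ≡ []
normP-IsZero []      p≈0 = refl
normP-IsZero (a ∷ p) p≈0 rewrite normP-IsZero p (λ i → p≈0 (suc i)) | p≈0 0 = refl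

private
  consN-nonzero : ∀ {c} → c ≢ 0ℤ → consN c [] ≡ c ∷ []
  consN-nonzero {c} c≢0 with c ℤ.≟ + 0
  ... | yes c≡0 = ⊥-elim (c≢0 c≡0)
  ... | no  _   = refl

  consN-∷ : ∀ a xs c → consN a (xs ++ c ∷ []) ≡ a ∷ xs ++ c ∷ []
  consN-∷ a []       c = refl
  consN-∷ a (x ∷ xs) c = refl

normP-Leading : ∀ {p n c} → Leading p n c → ∃ λ xs → normP p ≡ xs ++ c ∷ [] × length xs ≡ n
normP-Leading {[]} lp = ⊥-elim (Leading⇒¬IsZero lp (λ _ → refl))
normP-Leading {a ∷ p} {zero} {c} (leading a≡c c≢0 above)
  rewrite normP-IsZero p (λ i → above (suc i) (s≤s z≤n)) | a≡c = [] , consN-nonzero c≢0 , refl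
normP-Leading {a ∷ p} {suc n} {c} (leading p[n]≡c c≢0 above)
  with normP-Leading {p} (leading p[n]≡c c≢0 λ i n<i → above (suc i) (s≤s n<i))
... | xs , normp≡ , refl rewrite normp≡ = a ∷ xs , consN-∷ a xs c , refl

-- Division by a monic polynomial

-- Defs keeps the loop of quotMonic and its subtraction step private.  Both holes are
-- solved by unification against the two equations of this block, which recovers
-- them as functions that can be reasoned about.
mutual
  longDivision : List ℤ → ℕ → List ℤ → List ℤ
  longDivision = _

  subtractShifted : ℤ → List ℤ → List ℤ → List ℤ
  subtractShifted = _

  quotMonic-unfold : ∀ p d a rd → reverse (normP d) ≡ a ∷ rd →
    quotMonic p d ≡ reverse (longDivision rd (suc (length (reverse (normP p)) ∸ suc (length rd))) (reverse (normP p)))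
  quotMonic-unfold p d a rd eq with reverse (normP d) | eq
  ... | .(a ∷ rd) | refl with reverse (normP p)
  ...   | rp with suc (length rp ∸ suc (length rd))
  ...     | k with reverse {A = ℤ}
  ...       | rev = refl

  longDivision-suc : ∀ rd k c r → longDivision rd (suc k) (c ∷ r) ≡ c ∷ longDivision rd k (subtractShifted c rd r)
  longDivision-suc rd k c r = refl

longDivisionRemainder : List ℤ → ℕ → List ℤ → List ℤ
longDivisionRemainder rd zero    r       = r
longDivisionRemainder rd (suc k) []      = []
longDivisionRemainder rd (suc k) (c ∷ r) = longDivisionRemainder rd k (subtractShifted c rd r)

evalRev : List ℤ → ℤ → ℤ
evalRev []      z = 0ℤ
evalRev (c ∷ r) z = c * z ^ length r + evalRev r z

eval-reverse : ∀ xs z → eval (reverse xs) z ≡ evalRev xs z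
eval-reverse []       z = refl
eval-reverse (x ∷ xs) z
  rewrite LP.unfold-reverse x xs | eval-++ (reverse xs) (x ∷ []) z | eval-reverse xs z | LP.length-reverse xs
  = lemma (evalRev xs z) (z ^ length xs) x z
  where lemma : ∀ h w x z → h + w * (x + z * 0ℤ) ≡ x * w + h
        lemma = solve-∀

subtractShifted-correct : ∀ c es r → length es ≤ length r →
  length (subtractShifted c es r) ≡ length r ×
  (∀ z → evalRev (subtractShifted c es r) z ≡ evalRev r z - c * z ^ (length r ∸ length es) * evalRev es z)
subtractShifted-correct c [] r _ = refl , λ z → lemma (evalRev r z) c (z ^ length r)
  where lemma : ∀ h c w → h ≡ h - c * w * 0ℤ
        lemma = solve-∀
subtractShifted-correct c (e ∷ es) (x ∷ xs) (s≤s es≤xs) with subtractShifted-correct c es xs es≤xs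
... | length≡ , value≡ = cong suc length≡ , value
  where
  d : ℕ
  d = length xs ∸ length es
  split : ∀ z → z ^ length xs ≡ z ^ d * z ^ length es
  split z = trans (cong (z ^_) (sym (ℕP.m∸n+n≡m es≤xs))) (ℤP.^-distribˡ-+-* z d (length es))
  lemma : ∀ x c e w₁ w₂ h E → (x - c * e) * (w₁ * w₂) + (h - c * w₁ * E) ≡ (x * (w₁ * w₂) + h) - c * w₁ * (e * w₂ + E)
  lemma = solve-∀
  value : ∀ z → evalRev (subtractShifted c (e ∷ es) (x ∷ xs)) z ≡ evalRev (x ∷ xs) z - c * z ^ d * evalRev (e ∷ es) z
  value z rewrite length≡ | value≡ z | split z = lemma x c e (z ^ d) (z ^ length es) (evalRev xs z) (evalRev es z)

longDivision-correct : ∀ rd k r → length r ≡ k ℕ.+ length rd →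
  length (longDivision rd k r) ≡ k × length (longDivisionRemainder rd k r) ≡ length rd ×
  (∀ z → evalRev r z ≡ evalRev (longDivision rd k r) z * (z ^ length rd + evalRev rd z) + evalRev (longDivisionRemainder rd k r) z)
longDivision-correct rd zero r len = refl , len , λ z →
  sym (trans (cong (_+ evalRev r z) (ℤP.*-zeroˡ (z ^ length rd + evalRev rd z))) (ℤP.+-identityˡ _))
longDivision-correct rd (suc k) (c ∷ r) len
  with subtractShifted-correct c rd r (subst (length rd ≤_) (sym (ℕP.suc-injective len)) (ℕP.m≤n+m (length rd) k))
... | sub-length , sub-value with longDivision-correct rd k (subtractShifted c rd r) (trans sub-length (ℕP.suc-injective len))
...   | quot-length , rem-length , value≡ = cong suc quot-length , rem-length , value
  where
  m : ℕ
  m = length rd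
  length-r : length r ≡ k ℕ.+ m
  length-r = ℕP.suc-injective len
  Q : List ℤ
  Q = longDivision rd k (subtractShifted c rd r)
  split : ∀ z → z ^ length r ≡ z ^ k * z ^ m
  split z = trans (cong (z ^_) length-r) (ℤP.^-distribˡ-+-* z k m)
  lemma : ∀ c wk wm Q E Rm S r → S ≡ Q * (wm + E) + Rm → S ≡ r - c * wk * E →
          c * (wk * wm) + r ≡ (c * wk + Q) * (wm + E) + Rm
  lemma c wk wm Q E Rm S r eq₁ eq₂ = begin
    c * (wk * wm) + r                                  ≡⟨ lemma₁ c wk wm E r ⟩
    c * (wk * wm) + (r - c * wk * E) + c * wk * E      ≡⟨ cong (λ t → c * (wk * wm) + t + c * wk * E) (trans (sym eq₂) eq₁) ⟩
    c * (wk * wm) + (Q * (wm + E) + Rm) + c * wk * E   ≡⟨ lemma₂ c wk wm Q E Rm ⟩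
    (c * wk + Q) * (wm + E) + Rm                       ∎
    where
    open ≡-Reasoning
    lemma₁ : ∀ c wk wm E r → c * (wk * wm) + r ≡ c * (wk * wm) + (r - c * wk * E) + c * wk * E
    lemma₁ = solve-∀
    lemma₂ : ∀ c wk wm Q E Rm → c * (wk * wm) + (Q * (wm + E) + Rm) + c * wk * E ≡ (c * wk + Q) * (wm + E) + Rm
    lemma₂ = solve-∀
  value : ∀ z → evalRev (c ∷ r) z ≡ evalRev (longDivision rd (suc k) (c ∷ r)) z * (z ^ m + evalRev rd z)
                                    + evalRev (longDivisionRemainder rd (suc k) (c ∷ r)) z
  value z rewrite longDivision-suc rd k c r | quot-length
    | split z =
    lemma c (z ^ k) (z ^ m) (evalRev Q z) (evalRev rd z) (evalRev (longDivisionRemainder rd k (subtractShifted c rd r)) z)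
      (evalRev (subtractShifted c rd r) z) (evalRev r z)
      (value≡ z) (trans (sub-value z) (cong (λ t → evalRev r z - c * z ^ t * evalRev rd z)
                                            (trans (cong (_∸ m) length-r) (ℕP.m+n∸n≡m k m))))

quotMonic-division : ∀ {p D m n c} → Monic D m → Leading p n c → m ≤ n →
  ∃ λ R → length R ≡ m × (∀ z → eval p z ≡ eval (quotMonic p D) z * eval D z + eval R z)
quotMonic-division {p} {D} {m} {n} {c} monic lp m≤n
  with normP-Leading monic | normP-Leading lp
... | xs , normD≡ , length-xs | ys , normp≡ , length-ys = R , length-R , value
  where
  rd rp : List ℤ
  rd = reverse xs
  rp = reverse (normP p)
  reverse-D : reverse (normP D) ≡ 1ℤ ∷ rd
  reverse-D rewrite normD≡ = LP.reverse-++ xs (1ℤ ∷ [])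
  length-rd : length rd ≡ m
  length-rd = trans (LP.length-reverse xs) length-xs
  length-rp : length rp ≡ suc n
  length-rp rewrite normp≡ = trans (LP.length-reverse (ys ++ c ∷ []))
    (trans (LP.length-++ ys) (trans (ℕP.+-comm (length ys) 1) (cong suc length-ys)))
  k : ℕ
  k = suc (length rp ∸ suc (length rd))
  length-rp≡ : length rp ≡ k ℕ.+ length rd
  length-rp≡ rewrite length-rp | length-rd = cong suc (sym (ℕP.m∸n+n≡m m≤n))
  division : length (longDivision rd k rp) ≡ k × length (longDivisionRemainder rd k rp) ≡ length rd ×
             (∀ z → evalRev rp z ≡ evalRev (longDivision rd k rp) z * (z ^ length rd + evalRev rd z)
                                    + evalRev (longDivisionRemainder rd k rp) z)
  division = longDivision-correct rd k rp length-rp≡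
  R : Poly
  R = reverse (longDivisionRemainder rd k rp)
  length-R : length R ≡ m
  length-R = trans (LP.length-reverse (longDivisionRemainder rd k rp)) (trans (proj₁ (proj₂ division)) length-rd)
  eval-D : ∀ z → eval D z ≡ z ^ length rd + evalRev rd z
  eval-D z = begin
    eval D z                             ≡⟨ eval-viaRev D z ⟩
    evalRev (reverse (normP D)) z        ≡⟨ cong (λ t → evalRev t z) reverse-D ⟩
    1ℤ * z ^ length rd + evalRev rd z    ≡⟨ cong (_+ evalRev rd z) (ℤP.*-identityˡ (z ^ length rd)) ⟩
    z ^ length rd + evalRev rd z         ∎
    where
    open ≡-Reasoning
    eval-viaRev : ∀ p z → eval p z ≡ evalRev (reverse (normP p)) z
    eval-viaRev p z = trans (sym (eval-normP p z))
      (trans (cong (λ t → eval t z) (sym (LP.reverse-involutive (normP p)))) (eval-reverse (reverse (normP p)) z))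
  value : ∀ z → eval p z ≡ eval (quotMonic p D) z * eval D z + eval R z
  value z rewrite quotMonic-unfold p D 1ℤ rd reverse-D | eval-reverse (longDivision rd k rp) z
    | eval-reverse (longDivisionRemainder rd k rp) z | eval-D z =
    trans (sym (eval-normP p z)) (trans (cong (λ t → eval t z) (sym (LP.reverse-involutive (normP p))))
      (trans (eval-reverse rp z) (proj₂ (proj₂ division) z)))

-- Divisibility and coprimality over ℚ

infix 4 _∣ₑ_ _∣ℚ_

record _∣ₑ_ (f g : Poly) : Set where
  constructor divₑ
  field
    quotient : Poly
    equation : ∀ z → eval g z ≡ eval f z * eval quotient z

-- Divisibility in ℚ[x], with the denominators cleared into the nonzero integer scale.
record _∣ℚ_ (f g : Poly) : Set where
  constructor divℚ
  field
    cofactor : Poly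
    scale    : ℤ
    scale≢0  : scale ≢ 0ℤ
    equation : ∀ z → eval f z * eval cofactor z ≡ scale * eval g z

private
  *-cancelˡ-nonzero : ∀ K {x y} → K ≢ 0ℤ → K * x ≡ K * y → x ≡ y
  *-cancelˡ-nonzero K {x} {y} K≢0 = ℤP.*-cancelˡ-≡ K x y {{ℤ.≢-nonZero K≢0}}

  vanishes-if-scaled-vanishes : ∀ {K} g → K ≢ 0ℤ → (∀ z → K * eval g z ≡ 0ℤ) → IsZero g
  vanishes-if-scaled-vanishes {K} g K≢0 Kg≡0 = eval-injective {g} {[]} λ z →
    *-cancelˡ-nonzero K K≢0 (trans (Kg≡0 z) (sym (ℤP.*-zeroʳ K)))

∣ℚ⇒degree-≤ : ∀ {D p m n a c} → Leading D m a → Leading p n c → D ∣ℚ p → m ≤ n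
∣ℚ⇒degree-≤ {D} {p} {m} {n} {a} {c} lD lp (divℚ s K K≢0 eq) with Leading-or-zero s
... | inj₁ s≈0 = ⊥-elim (Leading⇒¬IsZero lp (vanishes-if-scaled-vanishes p K≢0 λ z →
  trans (sym (eq z)) (trans (cong (eval D z *_) (IsZero⇒eval≡0 s s≈0 z)) (ℤP.*-zeroʳ (eval D z)))))
... | inj₂ (j , c′ , ls) = subst (m ≤_) (proj₁ (Leading-unique Ds-leading Kp-leading)) (ℕP.m≤m+n m j)
  where
  Ds-leading : Leading (scaleP K p) (m ℕ.+ j) (a * c′)
  Ds-leading = Leading-resp {D *P s} {scaleP K p} (λ z → trans (eval-*P D s z) (trans (eq z) (sym (eval-scaleP K p z))))
                 (Leading-*P lD ls)
  Kp-leading : Leading (scaleP K p) n (K * c)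
  Kp-leading = Leading-scaleP K≢0 lp

-- With D·s = K·p and p = Q·D + R, deg R < deg D:  D·(s − K·Q) = K·R, so comparing degrees
-- gives s − K·Q = 0 and then R = 0.
quotMonic-exact : ∀ {D p m n c} → Monic D m → Leading p n c → D ∣ℚ p →
                  ∀ z → eval (quotMonic p D) z * eval D z ≡ eval p z
quotMonic-exact {D} {p} {m} monic lp D∣p@(divℚ s K K≢0 eq) z
  with quotMonic-division monic lp (∣ℚ⇒degree-≤ monic lp D∣p)
... | R , length-R , division = begin
  eval Q z * eval D z            ≡⟨ sym (ℤP.+-identityʳ _) ⟩
  eval Q z * eval D z + 0ℤ       ≡⟨ cong (_+_ (eval Q z * eval D z)) (sym (IsZero⇒eval≡0 R R≈0 z)) ⟩
  eval Q z * eval D z + eval R z ≡⟨ sym (division z) ⟩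
  eval p z                       ∎
  where
  open ≡-Reasoning
  Q t : Poly
  Q = quotMonic p D
  t = s +P scaleP (- K) Q
  Dt≡KR : ∀ z → eval D z * eval t z ≡ K * eval R z
  Dt≡KR z rewrite eval-+P s (scaleP (- K) Q) z | eval-scaleP (- K) Q z = begin
    eval D z * (eval s z + - K * eval Q z)               ≡⟨ lemma₁ (eval D z) (eval s z) K (eval Q z) ⟩
    eval D z * eval s z - K * (eval Q z * eval D z)      ≡⟨ cong (_- K * (eval Q z * eval D z)) (trans (eq z) (cong (K *_) (division z))) ⟩
    K * (eval Q z * eval D z + eval R z) - K * (eval Q z * eval D z) ≡⟨ lemma₂ K (eval Q z * eval D z) (eval R z) ⟩
    K * eval R z                                         ∎
    where
    lemma₁ : ∀ d s K q → d * (s + - K * q) ≡ d * s - K * (q * d)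
    lemma₁ = solve-∀
    lemma₂ : ∀ K a r → K * (a + r) - K * a ≡ K * r
    lemma₂ = solve-∀
  t≈0 : IsZero t
  t≈0 with Leading-or-zero t
  ... | inj₁ t≈0 = t≈0
  ... | inj₂ (j , c′ , lt) = ⊥-elim (Leading.lead≢0 KR-leading (trans (sym (Leading.coeff-degree KR-leading)) KR-high))
    where
    KR-leading : Leading (scaleP K R) (m ℕ.+ j) (1ℤ * c′)
    KR-leading = Leading-resp {D *P t} {scaleP K R} (λ z → trans (eval-*P D t z) (trans (Dt≡KR z) (sym (eval-scaleP K R z))))
                   (Leading-*P monic lt)
    KR-high : coeff (scaleP K R) (m ℕ.+ j) ≡ 0ℤ
    KR-high = trans (coeff-scaleP K R (m ℕ.+ j))
      (trans (cong (K *_) (coeff-length R (m ℕ.+ j) (subst (_≤ m ℕ.+ j) (sym length-R) (ℕP.m≤m+n m j)))) (ℤP.*-zeroʳ K))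
  R≈0 : IsZero R
  R≈0 = vanishes-if-scaled-vanishes R K≢0 λ z →
    trans (sym (Dt≡KR z)) (trans (cong (eval D z *_) (IsZero⇒eval≡0 t t≈0 z)) (ℤP.*-zeroʳ (eval D z)))

one : Poly
one = 1ℤ ∷ []

eval-one : ∀ z → eval one z ≡ 1ℤ
eval-one z = trans (cong (_+_ 1ℤ) (ℤP.*-zeroʳ z)) (ℤP.+-identityʳ 1ℤ)

eval-one-*P : ∀ p z → eval (one *P p) z ≡ eval p z
eval-one-*P p z = trans (eval-*P one p z) (trans (cong (_* eval p z) (eval-one z)) (ℤP.*-identityˡ _))

eval-*P-one : ∀ p z → eval (p *P one) z ≡ eval p z
eval-*P-one p z = trans (eval-*P p one z) (trans (cong (eval p z *_) (eval-one z)) (ℤP.*-identityʳ _))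

∣P⇒∣ₑ : ∀ {f} g → f ∣P g → f ∣ₑ g
∣P⇒∣ₑ {f} g (s , fs≈g) = divₑ s λ z → trans (sym (eval-≈P {f *P s} {g} fs≈g z)) (eval-*P f s z)

∣ₑ-resp : ∀ {f g g′} → eval g ≗ eval g′ → f ∣ₑ g → f ∣ₑ g′
∣ₑ-resp g≗g′ (divₑ s eq) = divₑ s λ z → trans (sym (g≗g′ z)) (eq z)

∣ₑ-trans : ∀ {f g h} → f ∣ₑ g → g ∣ₑ h → f ∣ₑ h
∣ₑ-trans {f} {g} {h} (divₑ s g≡fs) (divₑ t h≡gt) = divₑ (s *P t) λ z → begin
  eval h z                            ≡⟨ h≡gt z ⟩
  eval g z * eval t z                 ≡⟨ cong (_* eval t z) (g≡fs z) ⟩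
  eval f z * eval s z * eval t z      ≡⟨ ℤP.*-assoc (eval f z) _ _ ⟩
  eval f z * (eval s z * eval t z)    ≡⟨ cong (eval f z *_) (sym (eval-*P s t z)) ⟩
  eval f z * eval (s *P t) z          ∎
  where open ≡-Reasoning

∣ₑ-*Pʳ : ∀ f c → f ∣ₑ f *P c
∣ₑ-*Pʳ f c = divₑ c (eval-*P f c)

∣ₑ-*Pˡ : ∀ f c → f ∣ₑ c *P f
∣ₑ-*Pˡ f c = divₑ c λ z → trans (eval-*P c f z) (ℤP.*-comm (eval c z) (eval f z))

∣ₑ-prodP : ∀ {l L} → l ∈ L → l ∣ₑ prodP L
∣ₑ-prodP {l} {.l ∷ L} (here refl) = ∣ₑ-*Pʳ l (prodP L)
∣ₑ-prodP {l} {l′ ∷ L} (there l∈L) = ∣ₑ-trans {l} {prodP L} {l′ *P prodP L} (∣ₑ-prodP l∈L) (∣ₑ-*Pˡ (prodP L) l′)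

private
  *-≢0 : ∀ {a b} → a ≢ 0ℤ → b ≢ 0ℤ → a * b ≢ 0ℤ
  *-≢0 {a} a≢0 b≢0 ab≡0 = [ a≢0 , b≢0 ]′ (ℤP.i*j≡0⇒i≡0∨j≡0 a ab≡0)

∣ₑ⇒∣ℚ : ∀ {f g} → f ∣ₑ g → f ∣ℚ g
∣ₑ⇒∣ℚ {f} {g} (divₑ s eq) = divℚ s 1ℤ (λ ()) λ z → trans (sym (eq z)) (sym (ℤP.*-identityˡ (eval g z)))

∣ℚ-resp : ∀ {f g g′} → eval g ≗ eval g′ → f ∣ℚ g → f ∣ℚ g′
∣ℚ-resp {f} g≗g′ (divℚ s K K≢0 eq) = divℚ s K K≢0 λ z → trans (eq z) (cong (K *_) (g≗g′ z))

∣ℚ-∣ₑ-trans : ∀ {f g h} → f ∣ℚ g → g ∣ₑ h → f ∣ℚ h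
∣ℚ-∣ₑ-trans {f} {g} {h} (divℚ s K K≢0 eq) (divₑ t h≡gt) = divℚ (s *P t) K K≢0 λ z → begin
  eval f z * eval (s *P t) z          ≡⟨ cong (eval f z *_) (eval-*P s t z) ⟩
  eval f z * (eval s z * eval t z)    ≡⟨ sym (ℤP.*-assoc (eval f z) _ _) ⟩
  eval f z * eval s z * eval t z      ≡⟨ cong (_* eval t z) (eq z) ⟩
  K * eval g z * eval t z             ≡⟨ ℤP.*-assoc K _ _ ⟩
  K * (eval g z * eval t z)           ≡⟨ cong (K *_) (sym (h≡gt z)) ⟩
  K * eval h z                        ∎
  where open ≡-Reasoning

∣ℚ-combination : ∀ {f g h} → f ∣ℚ g → f ∣ℚ h → ∀ a b → f ∣ℚ a *P g +P b *P h
∣ℚ-combination {f} {g} {h} (divℚ s K K≢0 eq) (divℚ t L L≢0 eq′) a b =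
  divℚ (scaleP L (a *P s) +P scaleP K (b *P t)) (K * L) (*-≢0 K≢0 L≢0) λ z → begin
    eval f z * eval (scaleP L (a *P s) +P scaleP K (b *P t)) z
      ≡⟨ cong (eval f z *_) (eval-cofactor z) ⟩
    eval f z * (L * (eval a z * eval s z) + K * (eval b z * eval t z))
      ≡⟨ lemma₁ (eval f z) L K (eval a z) (eval s z) (eval b z) (eval t z) ⟩
    L * eval a z * (eval f z * eval s z) + K * eval b z * (eval f z * eval t z)
      ≡⟨ cong₂ (λ u v → L * eval a z * u + K * eval b z * v) (eq z) (eq′ z) ⟩
    L * eval a z * (K * eval g z) + K * eval b z * (L * eval h z)
      ≡⟨ lemma₂ L K (eval a z) (eval b z) (eval g z) (eval h z) ⟩
    K * L * (eval a z * eval g z + eval b z * eval h z)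
      ≡⟨ cong (K * L *_) (sym (eval-combination z)) ⟩
    K * L * eval (a *P g +P b *P h) z ∎
  where
  open ≡-Reasoning
  eval-cofactor : ∀ z → eval (scaleP L (a *P s) +P scaleP K (b *P t)) z ≡ L * (eval a z * eval s z) + K * (eval b z * eval t z)
  eval-cofactor z rewrite eval-+P (scaleP L (a *P s)) (scaleP K (b *P t)) z | eval-scaleP L (a *P s) z
    | eval-scaleP K (b *P t) z | eval-*P a s z | eval-*P b t z = refl
  eval-combination : ∀ z → eval (a *P g +P b *P h) z ≡ eval a z * eval g z + eval b z * eval h z
  eval-combination z = trans (eval-+P (a *P g) (b *P h) z) (cong₂ _+_ (eval-*P a g z) (eval-*P b h z))
  lemma₁ : ∀ f L K a s b t → f * (L * (a * s) + K * (b * t)) ≡ L * a * (f * s) + K * b * (f * t)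
  lemma₁ = solve-∀
  lemma₂ : ∀ L K a b g h → L * a * (K * g) + K * b * (L * h) ≡ K * L * (a * g + b * h)
  lemma₂ = solve-∀

∣ℚ-unscale : ∀ {f g c} → c ≢ 0ℤ → f ∣ℚ scaleP c g → f ∣ℚ g
∣ℚ-unscale {f} {g} {c} c≢0 (divℚ s K K≢0 eq) = divℚ s (K * c) (*-≢0 K≢0 c≢0) λ z →
  trans (eq z) (trans (cong (K *_) (eval-scaleP c g z)) (sym (ℤP.*-assoc K c (eval g z))))

record Coprimeℚ (f g : Poly) : Set where
  constructor coprimeℚ
  field
    u v    : Poly
    k      : ℤ
    k≢0    : k ≢ 0ℤ
    bezout : ∀ z → eval u z * eval f z + eval v z * eval g z ≡ k

Coprimeℚ-resp : ∀ {f g g′} → eval g ≗ eval g′ → Coprimeℚ f g → Coprimeℚ f g′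
Coprimeℚ-resp {f} g≗g′ (coprimeℚ u v k k≢0 eq) = coprimeℚ u v k k≢0 λ z →
  trans (cong (λ t → eval u z * eval f z + eval v z * t) (sym (g≗g′ z))) (eq z)

Coprimeℚ-sym : ∀ {f g} → Coprimeℚ f g → Coprimeℚ g f
Coprimeℚ-sym {f} {g} (coprimeℚ u v k k≢0 eq) = coprimeℚ v u k k≢0 λ z →
  trans (ℤP.+-comm (eval v z * eval g z) (eval u z * eval f z)) (eq z)

Coprimeℚ-combination : ∀ {f g h} a b → (∀ z → eval g z ≡ eval a z * eval f z + eval b z * eval h z) →
                       Coprimeℚ f g → Coprimeℚ f h
Coprimeℚ-combination {f} {g} {h} a b g≡ (coprimeℚ u v k k≢0 eq) = coprimeℚ (u +P v *P a) (v *P b) k k≢0 λ z → begin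
  eval (u +P v *P a) z * eval f z + eval (v *P b) z * eval h z
    ≡⟨ cong₂ (λ s t → s * eval f z + t * eval h z)
             (trans (eval-+P u (v *P a) z) (cong (_+_ (eval u z)) (eval-*P v a z))) (eval-*P v b z) ⟩
  (eval u z + eval v z * eval a z) * eval f z + eval v z * eval b z * eval h z
    ≡⟨ lemma (eval u z) (eval v z) (eval a z) (eval b z) (eval f z) (eval h z) ⟩
  eval u z * eval f z + eval v z * (eval a z * eval f z + eval b z * eval h z)
    ≡⟨ cong (λ t → eval u z * eval f z + eval v z * t) (sym (g≡ z)) ⟩
  eval u z * eval f z + eval v z * eval g z
    ≡⟨ eq z ⟩
  k ∎
  where
  open ≡-Reasoning
  lemma : ∀ u v a b f h → (u + v * a) * f + v * b * h ≡ u * f + v * (a * f + b * h)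
  lemma = solve-∀

Coprimeℚ-∣ₑ : ∀ {f g h} → h ∣ₑ g → Coprimeℚ f g → Coprimeℚ f h
Coprimeℚ-∣ₑ {f} {g} {h} (divₑ t g≡ht) = Coprimeℚ-combination [] t λ z →
  trans (g≡ht z) (sym (trans (ℤP.+-identityˡ _) (ℤP.*-comm (eval t z) (eval h z))))

Coprimeℚ-one : ∀ f → Coprimeℚ f one
Coprimeℚ-one f = coprimeℚ [] one 1ℤ (λ ()) λ z →
  trans (cong (_+_ (0ℤ * eval f z)) (cong₂ _*_ (eval-one z) (eval-one z))) (ℤP.+-identityˡ 1ℤ)

Coprimeℚ-*P : ∀ {f g h} → Coprimeℚ f g → Coprimeℚ f h → Coprimeℚ f (g *P h)
Coprimeℚ-*P {f} {g} {h} (coprimeℚ u v k k≢0 eq) (coprimeℚ u′ v′ k′ k′≢0 eq′) =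
  coprimeℚ w (v *P v′) (k * k′) (*-≢0 k≢0 k′≢0) λ z → begin
    eval w z * eval f z + eval (v *P v′) z * eval (g *P h) z
      ≡⟨ cong₂ (λ s t → s * eval f z + t) (eval-w z) (cong₂ _*_ (eval-*P v v′ z) (eval-*P g h z)) ⟩
    (eval u z * eval u′ z * eval f z + (eval u z * eval v′ z * eval h z + eval v z * eval u′ z * eval g z)) * eval f z
      + eval v z * eval v′ z * (eval g z * eval h z)
      ≡⟨ lemma (eval u z) (eval f z) (eval v z) (eval g z) (eval u′ z) (eval v′ z) (eval h z) ⟩
    (eval u z * eval f z + eval v z * eval g z) * (eval u′ z * eval f z + eval v′ z * eval h z)
      ≡⟨ cong₂ _*_ (eq z) (eq′ z) ⟩
    k * k′ ∎
  where
  open ≡-Reasoning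
  w : Poly
  w = (u *P u′) *P f +P ((u *P v′) *P h +P (v *P u′) *P g)
  eval-w : ∀ z → eval w z ≡ eval u z * eval u′ z * eval f z + (eval u z * eval v′ z * eval h z + eval v z * eval u′ z * eval g z)
  eval-w z rewrite eval-+P ((u *P u′) *P f) ((u *P v′) *P h +P (v *P u′) *P g) z | eval-+P ((u *P v′) *P h) ((v *P u′) *P g) z
    | eval-*P (u *P u′) f z | eval-*P (u *P v′) h z | eval-*P (v *P u′) g z | eval-*P u u′ z | eval-*P u v′ z | eval-*P v u′ z = refl
  lemma : ∀ u f v g u′ v′ h → (u * u′ * f + (u * v′ * h + v * u′ * g)) * f + v * v′ * (g * h)
                              ≡ (u * f + v * g) * (u′ * f + v′ * h)
  lemma = solve-∀

Coprimeℚ-prodP : ∀ {f} L → All (Coprimeℚ f) L → Coprimeℚ f (prodP L)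
Coprimeℚ-prodP {f} []      []         = Coprimeℚ-one f
Coprimeℚ-prodP     (l ∷ L) (f⊥l ∷ f⊥L) = Coprimeℚ-*P f⊥l (Coprimeℚ-prodP L f⊥L)

Coprimeℚ-x^ : ∀ {f} → constTerm f ≢ 0ℤ → ∀ j → Coprimeℚ f (mono 1ℤ j)
Coprimeℚ-x^ {f} f₀≢0 zero    = Coprimeℚ-one f
Coprimeℚ-x^ {f} f₀≢0 (suc j) = Coprimeℚ-resp x·xʲ≡xʲ⁺¹ (Coprimeℚ-*P coprime-x (Coprimeℚ-x^ f₀≢0 j))
  where
  coprime-x : Coprimeℚ f (mono 1ℤ 1)
  coprime-x = coprimeℚ one (scaleP (- 1ℤ) (divX f)) (constTerm f) f₀≢0 λ z → begin
    eval one z * eval f z + eval (scaleP (- 1ℤ) (divX f)) z * eval (mono 1ℤ 1) z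
      ≡⟨ cong₂ (λ u v → u * eval f z + v) (eval-one z) (cong₂ _*_ (eval-scaleP (- 1ℤ) (divX f) z) (eval-mono 1ℤ 1 z)) ⟩
    1ℤ * eval f z + - 1ℤ * eval (divX f) z * (1ℤ * (z * 1ℤ))
      ≡⟨ cong (λ t → 1ℤ * t + - 1ℤ * eval (divX f) z * (1ℤ * (z * 1ℤ))) (eval-constTerm-divX f z) ⟩
    1ℤ * (constTerm f + z * eval (divX f) z) + - 1ℤ * eval (divX f) z * (1ℤ * (z * 1ℤ))
      ≡⟨ lemma (constTerm f) z (eval (divX f) z) ⟩
    constTerm f ∎
    where
    open ≡-Reasoning
    lemma : ∀ c z d → 1ℤ * (c + z * d) + - 1ℤ * d * (1ℤ * (z * 1ℤ)) ≡ c
    lemma = solve-∀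
  x·xʲ≡xʲ⁺¹ : ∀ z → eval (mono 1ℤ 1 *P mono 1ℤ j) z ≡ eval (mono 1ℤ (suc j)) z
  x·xʲ≡xʲ⁺¹ z = begin
    eval (mono 1ℤ 1 *P mono 1ℤ j) z            ≡⟨ eval-*P (mono 1ℤ 1) (mono 1ℤ j) z ⟩
    eval (mono 1ℤ 1) z * eval (mono 1ℤ j) z    ≡⟨ cong₂ _*_ (eval-mono 1ℤ 1 z) (eval-mono 1ℤ j z) ⟩
    1ℤ * (z * 1ℤ) * (1ℤ * z ^ j)               ≡⟨ lemma z (z ^ j) ⟩
    1ℤ * (z * z ^ j)                           ≡⟨ sym (eval-mono 1ℤ (suc j) z) ⟩
    eval (mono 1ℤ (suc j)) z                   ∎
    where
    open ≡-Reasoning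
    lemma : ∀ z w → 1ℤ * (z * 1ℤ) * (1ℤ * w) ≡ 1ℤ * (z * w)
    lemma = solve-∀

Coprimeℚ-cancel : ∀ {f g h} → Coprimeℚ f g → f ∣ℚ g *P h → f ∣ℚ h
Coprimeℚ-cancel {f} {g} {h} (coprimeℚ u v k k≢0 eq) (divℚ s K K≢0 eq′) =
  divℚ w (k * K) (*-≢0 k≢0 K≢0) λ z → begin
    eval f z * eval w z
      ≡⟨ cong (eval f z *_) (eval-w z) ⟩
    eval f z * (K * (eval u z * eval h z) + eval v z * eval s z)
      ≡⟨ lemma₁ (eval f z) K (eval u z) (eval h z) (eval v z) (eval s z) ⟩
    K * eval h z * (eval u z * eval f z) + eval v z * (eval f z * eval s z)
      ≡⟨ cong (λ t → K * eval h z * (eval u z * eval f z) + eval v z * t) (trans (eq′ z) (cong (K *_) (eval-*P g h z))) ⟩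
    K * eval h z * (eval u z * eval f z) + eval v z * (K * (eval g z * eval h z))
      ≡⟨ lemma₂ K (eval h z) (eval u z) (eval f z) (eval v z) (eval g z) ⟩
    (eval u z * eval f z + eval v z * eval g z) * K * eval h z
      ≡⟨ cong (λ t → t * K * eval h z) (eq z) ⟩
    k * K * eval h z ∎
  where
  open ≡-Reasoning
  w : Poly
  w = scaleP K (u *P h) +P v *P s
  eval-w : ∀ z → eval w z ≡ K * (eval u z * eval h z) + eval v z * eval s z
  eval-w z rewrite eval-+P (scaleP K (u *P h)) (v *P s) z | eval-scaleP K (u *P h) z | eval-*P u h z | eval-*P v s z = refl
  lemma₁ : ∀ f K u h v s → f * (K * (u * h) + v * s) ≡ K * h * (u * f) + v * (f * s)
  lemma₁ = solve-∀
  lemma₂ : ∀ K h u f v g → K * h * (u * f) + v * (K * (g * h)) ≡ (u * f + v * g) * K * h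
  lemma₂ = solve-∀

Coprimeℚ-∣ℚ-*P : ∀ {a b F} → Coprimeℚ a b → a ∣ₑ F → b ∣ℚ F → a *P b ∣ℚ F
Coprimeℚ-∣ℚ-*P {a} {b} {F} (coprimeℚ u v k k≢0 eq) (divₑ t F≡at) (divℚ s K K≢0 eq′) =
  divℚ w (k * K) (*-≢0 k≢0 K≢0) λ z → begin
    eval (a *P b) z * eval w z
      ≡⟨ cong₂ _*_ (eval-*P a b z) (eval-w z) ⟩
    eval a z * eval b z * (eval u z * eval s z + K * (eval v z * eval t z))
      ≡⟨ lemma₁ (eval a z) (eval b z) (eval u z) (eval s z) K (eval v z) (eval t z) ⟩
    eval u z * eval a z * (eval b z * eval s z) + K * (eval v z * eval b z) * (eval a z * eval t z)
      ≡⟨ cong₂ (λ x y → eval u z * eval a z * x + K * (eval v z * eval b z) * y) (eq′ z) (sym (F≡at z)) ⟩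
    eval u z * eval a z * (K * eval F z) + K * (eval v z * eval b z) * eval F z
      ≡⟨ lemma₂ (eval u z) (eval a z) K (eval F z) (eval v z) (eval b z) ⟩
    (eval u z * eval a z + eval v z * eval b z) * K * eval F z
      ≡⟨ cong (λ x → x * K * eval F z) (eq z) ⟩
    k * K * eval F z ∎
  where
  open ≡-Reasoning
  w : Poly
  w = u *P s +P scaleP K (v *P t)
  eval-w : ∀ z → eval w z ≡ eval u z * eval s z + K * (eval v z * eval t z)
  eval-w z rewrite eval-+P (u *P s) (scaleP K (v *P t)) z | eval-scaleP K (v *P t) z | eval-*P u s z | eval-*P v t z = refl
  lemma₁ : ∀ a b u s K v t → a * b * (u * s + K * (v * t)) ≡ u * a * (b * s) + K * (v * b) * (a * t)
  lemma₁ = solve-∀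
  lemma₂ : ∀ u a K F v b → u * a * (K * F) + K * (v * b) * F ≡ (u * a + v * b) * K * F
  lemma₂ = solve-∀

prodP-∣ℚ : ∀ {F} L → AllPairs Coprimeℚ L → All (_∣ₑ F) L → prodP L ∣ℚ F
prodP-∣ℚ {F} [] [] [] = divℚ F 1ℤ (λ ()) λ z → cong (_* eval F z) (eval-one z)
prodP-∣ℚ (l ∷ L) (l⊥L ∷ L-pairwise) (l∣F ∷ L∣F) =
  Coprimeℚ-∣ℚ-*P (Coprimeℚ-prodP L l⊥L) l∣F (prodP-∣ℚ L L-pairwise L∣F)

∣ℚ-cancel-coprime-factors : ∀ {A : Set} (F : A → Poly) {f G h} ds → AllPairs _≢_ ds → h ∈ ds →
  (∀ {c} → c ∈ ds → c ≢ h → Coprimeℚ f (F c)) → f ∣ℚ G *P prodP (map F ds) → f ∣ℚ G *P F h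
∣ℚ-cancel-coprime-factors F {f} {G} (h ∷ ds) (h≢ds ∷ _) (here refl) coprime f∣ =
  Coprimeℚ-cancel (Coprimeℚ-prodP (map F ds) (AllP.map⁺ (All.tabulate λ c∈ → coprime (there c∈) (≢-sym (All.lookup h≢ds c∈)))))
    (∣ℚ-resp (λ z → rearrange (eval G z) (eval (F h) z) (eval (prodP (map F ds)) z)
                       (eval-*P G (F h *P prodP (map F ds)) z) (eval-*P (F h) (prodP (map F ds)) z)
                       (eval-*P (prodP (map F ds)) (G *P F h) z) (eval-*P G (F h) z)) f∣)
  where
  rearrange : ∀ {x y u v} a b c → x ≡ a * y → y ≡ b * c → u ≡ c * v → v ≡ a * b → x ≡ u
  rearrange a b c refl refl refl refl = lemma a b c
    where lemma : ∀ a b c → a * (b * c) ≡ c * (a * b)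
          lemma = solve-∀
∣ℚ-cancel-coprime-factors F {f} {G} {h} (c ∷ ds) (c≢ds ∷ ds-unique) (there h∈) coprime f∣ =
  ∣ℚ-cancel-coprime-factors F {G = G} ds ds-unique h∈ (λ c∈ → coprime (there c∈))
    (Coprimeℚ-cancel (coprime (here refl) (All.lookup c≢ds h∈))
      (∣ℚ-resp (λ z → rearrange (eval G z) (eval (F c) z) (eval (prodP (map F ds)) z)
                         (eval-*P G (F c *P prodP (map F ds)) z) (eval-*P (F c) (prodP (map F ds)) z)
                         (eval-*P (F c) (G *P prodP (map F ds)) z) (eval-*P G (prodP (map F ds)) z)) f∣))
  where
  rearrange : ∀ {x y u v} a b c → x ≡ a * y → y ≡ b * c → u ≡ b * v → v ≡ a * c → x ≡ u
  rearrange a b c refl refl refl refl = lemma a b c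
    where lemma : ∀ a b c → a * (b * c) ≡ b * (a * c)
          lemma = solve-∀

-- The substitutions x ↦ −x and x ↦ xᵏ

negx : Poly → Poly
negx []      = []
negx (a ∷ p) = a ∷ scaleP (- 1ℤ) (negx p)

eval-negx : ∀ p z → eval (negx p) z ≡ eval p (- z)
eval-negx []      z = refl
eval-negx (a ∷ p) z rewrite eval-scaleP (- 1ℤ) (negx p) z | eval-negx p z = lemma a z (eval p (- z))
  where lemma : ∀ a z x → a + z * (- 1ℤ * x) ≡ a + (- z) * x
        lemma = solve-∀

eval-negx-prodP : ∀ L z → eval (negx (prodP L)) z ≡ eval (prodP (map negx L)) z
eval-negx-prodP []      z = refl
eval-negx-prodP (l ∷ L) z = begin
  eval (negx (l *P prodP L)) z                   ≡⟨ eval-negx (l *P prodP L) z ⟩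
  eval (l *P prodP L) (- z)                      ≡⟨ eval-*P l (prodP L) (- z) ⟩
  eval l (- z) * eval (prodP L) (- z)            ≡⟨ cong₂ _*_ (sym (eval-negx l z))
                                                               (trans (sym (eval-negx (prodP L) z)) (eval-negx-prodP L z)) ⟩
  eval (negx l) z * eval (prodP (map negx L)) z  ≡⟨ sym (eval-*P (negx l) (prodP (map negx L)) z) ⟩
  eval (prodP (map negx (l ∷ L))) z              ∎
  where open ≡-Reasoning

compPow : ℕ → Poly → Poly
compPow k []      = []
compPow k (a ∷ p) = (a ∷ []) +P (mono 1ℤ k *P compPow k p)

eval-compPow : ∀ k p z → eval (compPow k p) z ≡ eval p (z ^ k)
eval-compPow k []      z = refl
eval-compPow k (a ∷ p) z
  rewrite eval-+P (a ∷ []) (mono 1ℤ k *P compPow k p) z | eval-*P (mono 1ℤ k) (compPow k p) z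
        | eval-mono 1ℤ k z | eval-compPow k p z | ℤP.*-zeroʳ z | ℤP.+-identityʳ a | ℤP.*-identityˡ (z ^ k)
  = refl

module Substitution (S : Poly → Poly) (σ : ℤ → ℤ) (eval-S : ∀ p z → eval (S p) z ≡ eval p (σ z)) where

  ∣ₑ-subst : ∀ {f g} → f ∣ₑ g → S f ∣ₑ S g
  ∣ₑ-subst {f} {g} (divₑ s eq) = divₑ (S s) λ z → trans (eval-S g z) (trans (eq (σ z)) (sym (cong₂ _*_ (eval-S f z) (eval-S s z))))

  Coprimeℚ-subst : ∀ {f g} → Coprimeℚ f g → Coprimeℚ (S f) (S g)
  Coprimeℚ-subst {f} {g} (coprimeℚ u v k k≢0 eq) = coprimeℚ (S u) (S v) k k≢0 λ z →
    trans (cong₂ _+_ (cong₂ _*_ (eval-S u z) (eval-S f z)) (cong₂ _*_ (eval-S v z) (eval-S g z))) (eq (σ z))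

∣ₑ-negx : ∀ {f g} → f ∣ₑ g → negx f ∣ₑ negx g
∣ₑ-negx = Substitution.∣ₑ-subst negx -_ eval-negx

∣ₑ-compPow : ∀ k {f g} → f ∣ₑ g → compPow k f ∣ₑ compPow k g
∣ₑ-compPow k = Substitution.∣ₑ-subst (compPow k) (_^ k) (eval-compPow k)

Coprimeℚ-compPow : ∀ k {f g} → Coprimeℚ f g → Coprimeℚ (compPow k f) (compPow k g)
Coprimeℚ-compPow k = Substitution.Coprimeℚ-subst (compPow k) (_^ k) (eval-compPow k)

eval-compPow-xnm1 : ∀ p g z → eval (compPow p (xnm1 g)) z ≡ eval (xnm1 (p ℕ.* g)) z
eval-compPow-xnm1 p g z rewrite eval-compPow p (xnm1 g) z | eval-xnm1 g (z ^ p) | eval-xnm1 (p ℕ.* g) z =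
  cong (_- 1ℤ) (ℤP.^-*-assoc z p g)

Leading-compPow : ∀ k {q m c} → 1 ≤ k → Leading q m c → Leading (compPow k q) (k ℕ.* m) c
Leading-compPow k {[]} _ lq = ⊥-elim (Leading⇒¬IsZero lq (λ _ → refl))
Leading-compPow k {a ∷ r} {zero} {c} _ lq@(leading a≡c c≢0 above) =
  subst (λ i → Leading (compPow k (a ∷ r)) i c) (sym (ℕP.*-zeroʳ k)) (Leading-resp constant (Leading-const c≢0))
  where
  q≈c : a ∷ r ≈ᶜ c ∷ []
  q≈c zero    = a≡c
  q≈c (suc i) = above (suc i) (s≤s z≤n)
  constant : ∀ z → eval (c ∷ []) z ≡ eval (compPow k (a ∷ r)) z
  constant z = begin
    eval (c ∷ []) z          ≡⟨ trans (eval-one-term c z) (sym (eval-one-term c (z ^ k))) ⟩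
    eval (c ∷ []) (z ^ k)    ≡⟨ sym (≈ᶜ⇒eval {a ∷ r} {c ∷ []} q≈c (z ^ k)) ⟩
    eval (a ∷ r) (z ^ k)     ≡⟨ sym (eval-compPow k (a ∷ r) z) ⟩
    eval (compPow k (a ∷ r)) z ∎
    where
    open ≡-Reasoning
    eval-one-term : ∀ c z → eval (c ∷ []) z ≡ c
    eval-one-term c z = trans (cong (_+_ c) (ℤP.*-zeroʳ z)) (ℤP.+-identityʳ c)
Leading-compPow k {a ∷ r} {suc m} {c} 1≤k (leading r[m]≡c c≢0 above) =
  subst (λ i → Leading (compPow k (a ∷ r)) i c) (sym (ℕP.*-suc k m)) (Leading-resp swap
    (Leading-+P-lower {q = a ∷ []} (subst (Leading (mono 1ℤ k *P compPow k r) (k ℕ.+ k ℕ.* m)) (ℤP.*-identityˡ c)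
      (Leading-*P (Leading-mono k (λ ())) (Leading-compPow k {r} 1≤k (leading r[m]≡c c≢0 λ i m<i → above (suc i) (s≤s m<i)))))
      constant-low))
  where
  constant-low : ∀ i → k ℕ.+ k ℕ.* m ≤ i → coeff (a ∷ []) i ≡ 0ℤ
  constant-low zero    k+km≤0 = ⊥-elim (ℕP.<-irrefl refl (ℕP.≤-trans (ℕP.≤-trans 1≤k (ℕP.m≤m+n k (k ℕ.* m))) k+km≤0))
  constant-low (suc i) _      = refl
  swap : ∀ z → eval ((mono 1ℤ k *P compPow k r) +P (a ∷ [])) z ≡ eval (compPow k (a ∷ r)) z
  swap z rewrite eval-+P (mono 1ℤ k *P compPow k r) (a ∷ []) z | eval-+P (a ∷ []) (mono 1ℤ k *P compPow k r) z =
    ℤP.+-comm (eval (mono 1ℤ k *P compPow k r) z) _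

-- The polynomials xⁿ − 1

-- xDerivFrom k p is x·(x^k p)′ / x^k, so that xDeriv = xDerivFrom 0 is x·d/dx.
xDerivFrom : ℕ → Poly → Poly
xDerivFrom k []      = []
xDerivFrom k (a ∷ p) = (+ k * a) ∷ xDerivFrom (suc k) p

xDeriv : Poly → Poly
xDeriv = xDerivFrom 0

coeff-xDerivFrom : ∀ k p i → coeff (xDerivFrom k p) i ≡ + (k ℕ.+ i) * coeff p i
coeff-xDerivFrom k []      i       = sym (ℤP.*-zeroʳ (+ (k ℕ.+ i)))
coeff-xDerivFrom k (a ∷ p) zero    rewrite ℕP.+-identityʳ k = refl
coeff-xDerivFrom k (a ∷ p) (suc i) rewrite coeff-xDerivFrom (suc k) p i | ℕP.+-suc k i = refl

xDeriv-resp : ∀ {p q} → eval p ≗ eval q → eval (xDeriv p) ≗ eval (xDeriv q)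
xDeriv-resp {p} {q} p≗q = ≈ᶜ⇒eval {xDeriv p} {xDeriv q} λ i →
  trans (coeff-xDerivFrom 0 p i) (trans (cong (+ i *_) (eval-injective {p} {q} p≗q i)) (sym (coeff-xDerivFrom 0 q i)))

eval-xDerivFrom : ∀ k p z → eval (xDerivFrom k p) z ≡ + k * eval p z + eval (xDeriv p) z
eval-xDerivFrom k []      z = cong (_+ 0ℤ) (sym (ℤP.*-zeroʳ (+ k)))
eval-xDerivFrom k (a ∷ p) z rewrite eval-xDerivFrom (suc k) p z | eval-xDerivFrom 1 p z | ℤP.*-zeroˡ a =
  lemma (+ k) a z (eval p z) (eval (xDeriv p) z)
  where lemma : ∀ k a z P D → k * a + z * ((1ℤ + k) * P + D) ≡ k * (a + z * P) + (0ℤ + z * (1ℤ * P + D))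
        lemma = solve-∀

private
  xDerivFrom-+P : ∀ k p q z → eval (xDerivFrom k (p +P q)) z ≡ eval (xDerivFrom k p) z + eval (xDerivFrom k q) z
  xDerivFrom-+P k []      q       z = sym (ℤP.+-identityˡ _)
  xDerivFrom-+P k (a ∷ p) []      z = sym (ℤP.+-identityʳ _)
  xDerivFrom-+P k (a ∷ p) (b ∷ q) z rewrite xDerivFrom-+P (suc k) p q z =
    lemma (+ k) a b z (eval (xDerivFrom (suc k) p) z) (eval (xDerivFrom (suc k) q) z)
    where lemma : ∀ k a b z x y → k * (a + b) + z * (x + y) ≡ (k * a + z * x) + (k * b + z * y)
          lemma = solve-∀

  xDerivFrom-scaleP : ∀ k c p z → eval (xDerivFrom k (scaleP c p)) z ≡ c * eval (xDerivFrom k p) z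
  xDerivFrom-scaleP k c []      z = sym (ℤP.*-zeroʳ c)
  xDerivFrom-scaleP k c (a ∷ p) z rewrite xDerivFrom-scaleP (suc k) c p z =
    lemma (+ k) c a z (eval (xDerivFrom (suc k) p) z)
    where lemma : ∀ k c a z x → k * (c * a) + z * (c * x) ≡ c * (k * a + z * x)
          lemma = solve-∀

  xDerivFrom-mono : ∀ k c j z → eval (xDerivFrom k (mono c j)) z ≡ + (k ℕ.+ j) * (c * z ^ j)
  xDerivFrom-mono k c zero    z rewrite ℕP.+-identityʳ k = lemma (+ k) c z
    where lemma : ∀ k c z → k * c + z * 0ℤ ≡ k * (c * 1ℤ)
          lemma = solve-∀
  xDerivFrom-mono k c (suc j) z rewrite xDerivFrom-mono (suc k) c j z | ℕP.+-suc k j =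
    lemma (+ k) (+ suc (k ℕ.+ j)) c z (z ^ j)
    where lemma : ∀ k K c z w → k * 0ℤ + z * (K * (c * w)) ≡ K * (c * (z * w))
          lemma = solve-∀

xDeriv-*P : ∀ p q z → eval (xDeriv (p *P q)) z ≡ eval (xDeriv p) z * eval q z + eval p z * eval (xDeriv q) z
xDeriv-*P []      q z = sym (trans (cong (_+ 0ℤ * eval (xDeriv q) z) (ℤP.*-zeroˡ (eval q z))) (ℤP.*-zeroˡ (eval (xDeriv q) z)))
xDeriv-*P (a ∷ p) q z
  rewrite xDerivFrom-+P 0 (scaleP a q) (+ 0 ∷ (p *P q)) z | xDerivFrom-scaleP 0 a q z | eval-xDerivFrom 1 (p *P q) z
        | xDeriv-*P p q z | eval-*P p q z | eval-xDerivFrom 1 p z | ℤP.*-zeroˡ a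
  = lemma a z (eval p z) (eval q z) (eval (xDeriv p) z) (eval (xDeriv q) z)
  where lemma : ∀ a z P Q Dp Dq → a * Dq + (0ℤ * 0ℤ + z * (1ℤ * (P * Q) + (Dp * Q + P * Dq)))
                                  ≡ (0ℤ + z * (1ℤ * P + Dp)) * Q + (a + z * P) * Dq
        lemma = solve-∀

eval-xDeriv-xnm1 : ∀ n z → eval (xDeriv (xnm1 n)) z ≡ + n * z ^ n
eval-xDeriv-xnm1 n z rewrite xDerivFrom-+P 0 (mono 1ℤ n) (mono (- 1ℤ) 0) z | xDerivFrom-mono 0 1ℤ n z
  | xDerivFrom-mono 0 (- 1ℤ) 0 z = lemma (+ n) (z ^ n)
  where lemma : ∀ N w → N * (1ℤ * w) + 0ℤ * (- 1ℤ * 1ℤ) ≡ N * w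
        lemma = solve-∀

-- From A·B = xⁿ − 1:  (θB − n·B)·A + θA·B = θ(xⁿ − 1) − n·(xⁿ − 1) = n, where θ = x·d/dx.
xnm1-factors-coprime : ∀ n {A B} → (∀ z → eval A z * eval B z ≡ eval (xnm1 (suc n)) z) → Coprimeℚ A B
xnm1-factors-coprime n {A} {B} AB≡ = coprimeℚ u (xDeriv A) (+ N) (λ ()) λ z → begin
  eval u z * eval A z + eval (xDeriv A) z * eval B z
    ≡⟨ cong (λ t → t * eval A z + eval (xDeriv A) z * eval B z) (eval-u z) ⟩
  (eval (xDeriv B) z + - + N * eval B z) * eval A z + eval (xDeriv A) z * eval B z
    ≡⟨ lemma₁ (eval (xDeriv B) z) (+ N) (eval B z) (eval A z) (eval (xDeriv A) z) ⟩
  (eval (xDeriv A) z * eval B z + eval A z * eval (xDeriv B) z) - + N * (eval A z * eval B z)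
    ≡⟨ cong₂ (λ x y → x - + N * y) (product-rule z) (trans (AB≡ z) (eval-xnm1 N z)) ⟩
  + N * z ^ N - + N * (z ^ N - 1ℤ)
    ≡⟨ lemma₂ (+ N) (z ^ N) ⟩
  + N ∎
  where
  open ≡-Reasoning
  N : ℕ
  N = suc n
  u : Poly
  u = xDeriv B +P scaleP (- + N) B
  eval-u : ∀ z → eval u z ≡ eval (xDeriv B) z + - + N * eval B z
  eval-u z = trans (eval-+P (xDeriv B) (scaleP (- + N) B) z) (cong (_+_ (eval (xDeriv B) z)) (eval-scaleP (- + N) B z))
  product-rule : ∀ z → eval (xDeriv A) z * eval B z + eval A z * eval (xDeriv B) z ≡ + N * z ^ N
  product-rule z = trans (sym (xDeriv-*P A B z))
    (trans (xDeriv-resp {A *P B} {xnm1 N} (λ z → trans (eval-*P A B z) (AB≡ z)) z) (eval-xDeriv-xnm1 N z))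
  lemma₁ : ∀ DB K B A DA → (DB + - K * B) * A + DA * B ≡ (DA * B + A * DB) - K * (A * B)
  lemma₁ = solve-∀
  lemma₂ : ∀ K w → K * w - K * (w - 1ℤ) ≡ K
  lemma₂ = solve-∀

geomSum : ℕ → ℕ → Poly
geomSum a zero    = []
geomSum a (suc q) = one +P (mono 1ℤ a *P geomSum a q)

private
  xnm1-split : ∀ d e z → eval (xnm1 (d ℕ.+ e)) z ≡ z ^ d * eval (xnm1 e) z + eval (xnm1 d) z
  xnm1-split d e z rewrite eval-xnm1 (d ℕ.+ e) z | eval-xnm1 e z | eval-xnm1 d z | ℤP.^-distribˡ-+-* z d e =
    lemma (z ^ d) (z ^ e)
    where lemma : ∀ a b → a * b - 1ℤ ≡ a * (b - 1ℤ) + (a - 1ℤ)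
          lemma = solve-∀

xnm1-geomSum : ∀ a q z → eval (xnm1 (q ℕ.* a)) z ≡ eval (xnm1 a) z * eval (geomSum a q) z
xnm1-geomSum a zero    z rewrite eval-xnm1 0 z = sym (ℤP.*-zeroʳ (eval (xnm1 a) z))
xnm1-geomSum a (suc q) z = begin
  eval (xnm1 (a ℕ.+ q ℕ.* a)) z                               ≡⟨ xnm1-split a (q ℕ.* a) z ⟩
  z ^ a * eval (xnm1 (q ℕ.* a)) z + eval (xnm1 a) z           ≡⟨ cong (λ t → z ^ a * t + eval (xnm1 a) z) (xnm1-geomSum a q z) ⟩
  z ^ a * (eval (xnm1 a) z * eval (geomSum a q) z) + eval (xnm1 a) z
    ≡⟨ lemma (z ^ a) (eval (xnm1 a) z) (eval (geomSum a q) z) ⟩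
  eval (xnm1 a) z * (1ℤ + 1ℤ * z ^ a * eval (geomSum a q) z)  ≡⟨ cong (eval (xnm1 a) z *_) (sym eval-geomSum) ⟩
  eval (xnm1 a) z * eval (geomSum a (suc q)) z                ∎
  where
  open ≡-Reasoning
  lemma : ∀ w X G → w * (X * G) + X ≡ X * (1ℤ + 1ℤ * w * G)
  lemma = solve-∀
  eval-geomSum : eval (geomSum a (suc q)) z ≡ 1ℤ + 1ℤ * z ^ a * eval (geomSum a q) z
  eval-geomSum rewrite eval-+P one (mono 1ℤ a *P geomSum a q) z | eval-one z | eval-*P (mono 1ℤ a) (geomSum a q) z
    | eval-mono 1ℤ a z = refl

xnm1-∣ₑ : ∀ {a n} → a ∣ n → xnm1 a ∣ₑ xnm1 n
xnm1-∣ₑ {a} (divides q refl) = divₑ (geomSum a q) (xnm1-geomSum a q)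

XnCombination : ℕ → ℕ → ℕ → Set
XnCombination m n d = ∃₂ λ α β → ∀ z → eval α z * eval (xnm1 m) z + eval β z * eval (xnm1 n) z ≡ eval (xnm1 d) z

private
  XnCombination-sym : ∀ {m n d} → XnCombination m n d → XnCombination n m d
  XnCombination-sym {m} {n} (α , β , eq) = β , α , λ z → trans (ℤP.+-comm (eval β z * eval (xnm1 n) z) _) (eq z)

  -- From x^(d+e) − 1 = G·(x^m − 1) and x^e − 1 = H·(x^n − 1):  x^d − 1 = G·(x^m − 1) − x^d·H·(x^n − 1).
  XnCombination-split : ∀ {m n d e} → xnm1 m ∣ₑ xnm1 (d ℕ.+ e) → xnm1 n ∣ₑ xnm1 e → XnCombination m n d
  XnCombination-split {m} {n} {d} {e} (divₑ G eqG) (divₑ H eqH) = G , scaleP (- 1ℤ) (mono 1ℤ d *P H) , λ z → begin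
    eval G z * eval (xnm1 m) z + eval (scaleP (- 1ℤ) (mono 1ℤ d *P H)) z * eval (xnm1 n) z
      ≡⟨ cong₂ (λ s t → s + t * eval (xnm1 n) z) (ℤP.*-comm (eval G z) (eval (xnm1 m) z))
               (trans (eval-scaleP (- 1ℤ) (mono 1ℤ d *P H) z)
                      (cong (- 1ℤ *_) (trans (eval-*P (mono 1ℤ d) H z) (cong (_* eval H z) (eval-mono 1ℤ d z))))) ⟩
    eval (xnm1 m) z * eval G z + - 1ℤ * (1ℤ * z ^ d * eval H z) * eval (xnm1 n) z
      ≡⟨ cong (_+ - 1ℤ * (1ℤ * z ^ d * eval H z) * eval (xnm1 n) z) (sym (eqG z)) ⟩
    eval (xnm1 (d ℕ.+ e)) z + - 1ℤ * (1ℤ * z ^ d * eval H z) * eval (xnm1 n) z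
      ≡⟨ cong (_+ - 1ℤ * (1ℤ * z ^ d * eval H z) * eval (xnm1 n) z) (xnm1-split d e z) ⟩
    z ^ d * eval (xnm1 e) z + eval (xnm1 d) z + - 1ℤ * (1ℤ * z ^ d * eval H z) * eval (xnm1 n) z
      ≡⟨ cong (λ t → z ^ d * t + eval (xnm1 d) z + - 1ℤ * (1ℤ * z ^ d * eval H z) * eval (xnm1 n) z) (eqH z) ⟩
    z ^ d * (eval (xnm1 n) z * eval H z) + eval (xnm1 d) z + - 1ℤ * (1ℤ * z ^ d * eval H z) * eval (xnm1 n) z
      ≡⟨ lemma (z ^ d) (eval (xnm1 n) z) (eval H z) (eval (xnm1 d) z) ⟩
    eval (xnm1 d) z ∎
    where
    open ≡-Reasoning
    lemma : ∀ w X H D → w * (X * H) + D + - 1ℤ * (1ℤ * w * H) * X ≡ D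
    lemma = solve-∀

XnCombination-gcd : ∀ {m n d} → Bézout.Identity d m n → XnCombination m n d
XnCombination-gcd {m} {n} {d} (Bézout.+- x y eq) =
  XnCombination-split {m} {n} {d} {y ℕ.* n} (xnm1-∣ₑ (divides x eq)) (xnm1-∣ₑ (divides y refl))
XnCombination-gcd {m} {n} {d} (Bézout.-+ x y eq) =
  XnCombination-sym {n} {m} {d} (XnCombination-split {n} {m} {d} {x ℕ.* m} (xnm1-∣ₑ (divides y eq)) (xnm1-∣ₑ (divides x refl)))

-- Cyclotomic polynomials

ProperDivisor : ℕ → ℕ → Set
ProperDivisor n d = d ∣ n × 1 ≤ d × d < n

private
  range1-bounds : ∀ n → All (λ d → 1 ≤ d × d < n) (range1 n)
  range1-bounds zero          = []
  range1-bounds (suc zero)    = []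
  range1-bounds (suc (suc n)) =
    AllP.++⁺ (All.map (λ (1≤d , d<n) → 1≤d , ℕP.m<n⇒m<1+n d<n) (range1-bounds (suc n))) ((s≤s z≤n , ℕP.≤-refl) ∷ [])

  range1-sorted : ∀ n → AllPairs _<_ (range1 n)
  range1-sorted zero          = []
  range1-sorted (suc zero)    = []
  range1-sorted (suc (suc n)) = AllPairsP.++⁺ (range1-sorted (suc n)) ([] ∷ [])
    (All.map (λ (_ , d<n) → d<n ∷ []) (range1-bounds (suc n)))

  ∈-range1-suc : ∀ n {d} → 1 ≤ d → d ≤ n → d ∈ range1 (suc n)
  ∈-range1-suc zero    (s≤s _) ()
  ∈-range1-suc (suc n) 1≤d d≤n with ℕP.m≤n⇒m<n∨m≡n d≤n
  ... | inj₁ d<n  = MP.∈-++⁺ˡ (∈-range1-suc n 1≤d (ℕP.≤-pred d<n))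
  ... | inj₂ refl = MP.∈-++⁺ʳ (range1 (suc n)) (here refl)

  ∈-range1 : ∀ n {d} → 1 ≤ d → d < n → d ∈ range1 n
  ∈-range1 (suc n) 1≤d (s≤s d≤n) = ∈-range1-suc n 1≤d d≤n

∈-properDivisors⁻ : ∀ {n d} → d ∈ properDivisors n → ProperDivisor n d
∈-properDivisors⁻ {n} d∈ with MP.∈-filter⁻ (_∣? n) d∈
... | d∈range , d∣n = d∣n , All.lookup (range1-bounds n) d∈range

∈-properDivisors⁺ : ∀ {n d} → ProperDivisor n d → d ∈ properDivisors n
∈-properDivisors⁺ {n} (d∣n , 1≤d , d<n) = MP.∈-filter⁺ (_∣? n) (∈-range1 n 1≤d d<n) d∣n

properDivisors-unique : ∀ n → AllPairs _≢_ (properDivisors n)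
properDivisors-unique n = AllPairs.map ℕP.<⇒≢ (AllPairsP.filter⁺ (_∣? n) (range1-sorted n))

properΦProduct : ℕ → Poly
properΦProduct n = prodP (map Φ (properDivisors n))

private
  cycs-last : ℕ → Poly
  cycs-last n = quotMonic (xnm1 (suc n)) (prodP (map (λ d → lookupD (cycs n) (d ∸ 1)) (properDivisors (suc n))))

  cycs-length : ∀ n → length (cycs n) ≡ n
  cycs-length zero    = refl
  cycs-length (suc n) = trans (LP.length-++ (cycs n)) (trans (ℕP.+-comm (length (cycs n)) 1) (cong suc (cycs-length n)))

  lookupD-++ˡ : ∀ xs ys i → i < length xs → lookupD (xs ++ ys) i ≡ lookupD xs i
  lookupD-++ˡ (x ∷ xs) ys zero    _         = refl
  lookupD-++ˡ (x ∷ xs) ys (suc i) (s≤s i<n) = lookupD-++ˡ xs ys i i<n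

  lookupD-last : ∀ xs y → lookupD (xs ++ y ∷ []) (length xs) ≡ y
  lookupD-last []       y = refl
  lookupD-last (x ∷ xs) y = lookupD-last xs y

  cycs-extends : ∀ d n → d ≤ n → ∃ λ ys → cycs n ≡ cycs d ++ ys
  cycs-extends d n d≤n with ℕP.m≤n⇒m<n∨m≡n d≤n
  cycs-extends d n       d≤n | inj₂ refl = [] , sym (LP.++-identityʳ (cycs d))
  cycs-extends d (suc n) d≤n | inj₁ (s≤s d≤n′) with cycs-extends d n d≤n′
  ... | ys , cycs-n≡ = ys ++ cycs-last n ∷ [] ,
    trans (cong (_++ cycs-last n ∷ []) cycs-n≡) (LP.++-assoc (cycs d) ys (cycs-last n ∷ []))

  lookupD-cycs : ∀ d n → 1 ≤ d → d ≤ n → lookupD (cycs n) (d ∸ 1) ≡ Φ d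
  lookupD-cycs (suc d) n _ d<n with cycs-extends (suc d) n d<n
  ... | ys , cycs-n≡ rewrite cycs-n≡ =
    lookupD-++ˡ (cycs (suc d)) ys d (subst (d <_) (sym (cycs-length (suc d))) ℕP.≤-refl)

Φ-suc : ∀ n → Φ (suc n) ≡ quotMonic (xnm1 (suc n)) (properΦProduct (suc n))
Φ-suc n = trans (subst (λ k → lookupD (cycs n ++ cycs-last n ∷ []) k ≡ cycs-last n) (cycs-length n) (lookupD-last (cycs n) (cycs-last n)))
  (cong (λ L → quotMonic (xnm1 (suc n)) (prodP L)) (LP.map-cong-local (All.tabulate λ d∈ →
    let _ , 1≤d , d<n = ∈-properDivisors⁻ d∈ in lookupD-cycs _ n 1≤d (ℕP.≤-pred d<n))))

record IsCyclotomic (n : ℕ) : Set where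
  field
    degree        : ℕ
    monic         : Monic (Φ n) degree
    factorisation : ∀ z → eval (Φ n) z * eval (properΦProduct n) z ≡ eval (xnm1 n) z

CyclotomicBelow : ℕ → Set
CyclotomicBelow B = ∀ {d} → 1 ≤ d → d < B → IsCyclotomic d

Φ-∣ₑ-xnm1 : ∀ {n} → IsCyclotomic n → Φ n ∣ₑ xnm1 n
Φ-∣ₑ-xnm1 {n} Φn = divₑ (properΦProduct n) λ z → sym (IsCyclotomic.factorisation Φn z)

Φ-∣ₑ-properΦProduct : ∀ {n c} → c ∈ properDivisors n → Φ c ∣ₑ properΦProduct n
Φ-∣ₑ-properΦProduct c∈ = ∣ₑ-prodP (MP.∈-map⁺ Φ c∈)

Φ-coprime-properΦProduct : ∀ {n} → 1 ≤ n → IsCyclotomic n → Coprimeℚ (Φ n) (properΦProduct n)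
Φ-coprime-properΦProduct {suc n} _ Φn = xnm1-factors-coprime n (IsCyclotomic.factorisation Φn)

Φ-coprime-properDivisor : ∀ {n c} → 1 ≤ n → IsCyclotomic n → c ∈ properDivisors n → Coprimeℚ (Φ n) (Φ c)
Φ-coprime-properDivisor {n} 1≤n Φn c∈ = Coprimeℚ-∣ₑ (Φ-∣ₑ-properΦProduct {n} c∈) (Φ-coprime-properΦProduct 1≤n Φn)

private
  divisor-bounds : ∀ {g d} → g ∣ d → 1 ≤ d → 1 ≤ g × g ≤ d
  divisor-bounds {zero}  {suc d} 0∣d _ with () ← ND.0∣⇒≡0 0∣d
  divisor-bounds {suc g} {suc d} g∣d _ = s≤s z≤n , ND.∣⇒≤ g∣d

  ∣-≢⇒ProperDivisor : ∀ {g d} → g ∣ d → 1 ≤ d → g ≢ d → ProperDivisor d g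
  ∣-≢⇒ProperDivisor g∣d 1≤d g≢d = let 1≤g , g≤d = divisor-bounds g∣d 1≤d in g∣d , 1≤g , ℕP.≤∧≢⇒< g≤d g≢d

Φ-coprime-xnm1 : ∀ {n g} → IsCyclotomic n → IsCyclotomic g → ProperDivisor n g → Coprimeℚ (Φ n) (xnm1 g)
Φ-coprime-xnm1 {n} {g} Φn Φg (g∣n , 1≤g , g<n) =
  Coprimeℚ-resp (λ z → trans (eval-*P (Φ g) (properΦProduct g) z) (IsCyclotomic.factorisation Φg z)) (Coprimeℚ-*P
    (Φ-coprime-properDivisor 1≤n Φn (∈-properDivisors⁺ (g∣n , 1≤g , g<n)))
    (Coprimeℚ-prodP (map Φ (properDivisors g)) (AllP.map⁺ (All.tabulate λ c∈ →
      let c∣g , 1≤c , c<g = ∈-properDivisors⁻ c∈ in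
      Φ-coprime-properDivisor 1≤n Φn (∈-properDivisors⁺ (ND.∣-trans c∣g g∣n , 1≤c , ℕP.<-trans c<g g<n))))))
  where
  1≤n : 1 ≤ n
  1≤n = ℕP.≤-trans 1≤g (ℕP.<⇒≤ g<n)

private
  Φ-coprime-Φ-via-gcd : ∀ {d e g} → IsCyclotomic d → IsCyclotomic e → IsCyclotomic g → ProperDivisor d g →
                        XnCombination d e g → Coprimeℚ (Φ d) (Φ e)
  Φ-coprime-Φ-via-gcd {d} {e} {g} Φd Φe Φg g<d (α , β , eq) =
    Coprimeℚ-combination (α *P properΦProduct d) (β *P properΦProduct e) value (Φ-coprime-xnm1 Φd Φg g<d)
    where
    lemma : ∀ a f p b g q → a * (f * p) + b * (g * q) ≡ a * p * f + b * q * g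
    lemma = solve-∀
    value : ∀ z → eval (xnm1 g) z ≡ eval (α *P properΦProduct d) z * eval (Φ d) z + eval (β *P properΦProduct e) z * eval (Φ e) z
    value z = begin
      eval (xnm1 g) z
        ≡⟨ sym (eq z) ⟩
      eval α z * eval (xnm1 d) z + eval β z * eval (xnm1 e) z
        ≡⟨ cong₂ (λ x y → eval α z * x + eval β z * y)
                 (sym (IsCyclotomic.factorisation Φd z)) (sym (IsCyclotomic.factorisation Φe z)) ⟩
      eval α z * (eval (Φ d) z * eval (properΦProduct d) z) + eval β z * (eval (Φ e) z * eval (properΦProduct e) z)
        ≡⟨ lemma (eval α z) (eval (Φ d) z) (eval (properΦProduct d) z) (eval β z) (eval (Φ e) z) (eval (properΦProduct e) z) ⟩
      eval α z * eval (properΦProduct d) z * eval (Φ d) z + eval β z * eval (properΦProduct e) z * eval (Φ e) z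
        ≡⟨ sym (cong₂ (λ x y → x * eval (Φ d) z + y * eval (Φ e) z)
                      (eval-*P α (properΦProduct d) z) (eval-*P β (properΦProduct e) z)) ⟩
      eval (α *P properΦProduct d) z * eval (Φ d) z + eval (β *P properΦProduct e) z * eval (Φ e) z ∎
      where open ≡-Reasoning

Φ-coprime-Φ : ∀ {B d e} → CyclotomicBelow B → 1 ≤ d → d < B → 1 ≤ e → e < B → d ≢ e → Coprimeℚ (Φ d) (Φ e)
Φ-coprime-Φ {B} {d} {e} Φ<B 1≤d d<B 1≤e e<B d≢e with Bézout.lemma d e
... | Bézout.result g isGCD identity with g ℕ.≟ d
...   | no g≢d = Φ-coprime-Φ-via-gcd (Φ<B 1≤d d<B) (Φ<B 1≤e e<B) (Φ<B (proj₁ (proj₂ g<d)) (ℕP.<-trans (proj₂ (proj₂ g<d)) d<B))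
                   g<d (XnCombination-gcd identity)
  where
  g<d : ProperDivisor d g
  g<d = ∣-≢⇒ProperDivisor (GCD.gcd∣m isGCD) 1≤d g≢d
...   | yes refl = Coprimeℚ-sym (Φ-coprime-Φ-via-gcd (Φ<B 1≤e e<B) (Φ<B 1≤d d<B) (Φ<B 1≤d d<B)
                   (∣-≢⇒ProperDivisor (GCD.gcd∣n isGCD) 1≤e d≢e) (XnCombination-sym {d} {e} {d} (XnCombination-gcd identity)))

private
  AllPairs-map-∈ : ∀ {A B : Set} {S : A → A → Set} {R : B → B → Set} (f : A → B) {xs} → AllPairs S xs →
                   (∀ {x y} → x ∈ xs → y ∈ xs → S x y → R (f x) (f y)) → AllPairs R (map f xs)
  AllPairs-map-∈ f []       _    = []
  AllPairs-map-∈ f (s ∷ ss) f-ok =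
    AllP.map⁺ (All.tabulate λ y∈ → f-ok (here refl) (there y∈) (All.lookup s y∈)) ∷
    AllPairs-map-∈ f ss (λ x∈ y∈ → f-ok (there x∈) (there y∈))

-- Over ℚ the Φ d (d a proper divisor) are pairwise coprime divisors of xᴺ − 1, so their
-- monic product divides it, and the long division defining Φ N is exact.
IsCyclotomic-step : ∀ n → CyclotomicBelow (suc n) → IsCyclotomic (suc n)
IsCyclotomic-step n Φ<N = record { degree = proj₁ monic-Φ ; monic = proj₂ monic-Φ ; factorisation = factorisation }
  where
  N : ℕ
  N = suc n
  ds : List ℕ
  ds = properDivisors N
  below : ∀ {d} → d ∈ ds → IsCyclotomic d
  below d∈ = let _ , 1≤d , d<N = ∈-properDivisors⁻ d∈ in Φ<N 1≤d d<N
  pairwise : AllPairs Coprimeℚ (map Φ ds)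
  pairwise = AllPairs-map-∈ Φ (properDivisors-unique N) λ d∈ e∈ d≢e →
    let _ , 1≤d , d<N = ∈-properDivisors⁻ d∈ ; _ , 1≤e , e<N = ∈-properDivisors⁻ e∈ in
    Φ-coprime-Φ Φ<N 1≤d d<N 1≤e e<N d≢e
  divisors : All (_∣ₑ xnm1 N) (map Φ ds)
  divisors = AllP.map⁺ (All.tabulate λ d∈ →
    ∣ₑ-trans (Φ-∣ₑ-xnm1 (below d∈)) (xnm1-∣ₑ (proj₁ (∈-properDivisors⁻ {N} d∈))))
  monic-product : ∃ (Monic (properΦProduct N))
  monic-product = Monic-prodP (map Φ ds) (AllP.map⁺ (All.tabulate λ d∈ →
    IsCyclotomic.degree (below d∈) , IsCyclotomic.monic (below d∈)))
  factorisation : ∀ z → eval (Φ N) z * eval (properΦProduct N) z ≡ eval (xnm1 N) z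
  factorisation rewrite Φ-suc n =
    quotMonic-exact (proj₂ monic-product) (Monic-xnm1 n) (prodP-∣ℚ (map Φ ds) pairwise divisors)
  monic-Φ : ∃ (Monic (Φ N))
  monic-Φ = Monic-cofactor (proj₂ monic-product) (Monic-xnm1 n) factorisation

Φ-isCyclotomic : ∀ {n} → 1 ≤ n → IsCyclotomic n
Φ-isCyclotomic {n} = <-rec (λ n → 1 ≤ n → IsCyclotomic n) step n
  where
  step : ∀ n → (∀ {m} → m < n → 1 ≤ m → IsCyclotomic m) → 1 ≤ n → IsCyclotomic n
  step (suc n) below _ = IsCyclotomic-step n λ 1≤d d<N → below d<N 1≤d

Φ-constTerm≢0 : ∀ {n} → 1 ≤ n → constTerm (Φ n) ≢ 0ℤ
Φ-constTerm≢0 {suc n} 1≤n Φ₀≡0 = -1≢0 (begin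
  - 1ℤ                                              ≡⟨ sym (cong (_- 1ℤ) (ℤP.*-zeroˡ (0ℤ ^ n))) ⟩
  0ℤ ^ suc n - 1ℤ                                   ≡⟨ sym (eval-xnm1 (suc n) 0ℤ) ⟩
  eval (xnm1 (suc n)) 0ℤ                            ≡⟨ sym (IsCyclotomic.factorisation (Φ-isCyclotomic 1≤n) 0ℤ) ⟩
  eval (Φ (suc n)) 0ℤ * eval (properΦProduct (suc n)) 0ℤ ≡⟨ cong (_* eval (properΦProduct (suc n)) 0ℤ) Φ[0]≡0 ⟩
  0ℤ * eval (properΦProduct (suc n)) 0ℤ            ≡⟨ ℤP.*-zeroˡ (eval (properΦProduct (suc n)) 0ℤ) ⟩
  0ℤ                                                ∎)
  where
  open ≡-Reasoning
  -1≢0 : - 1ℤ ≢ 0ℤ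
  -1≢0 ()
  Φ[0]≡0 : eval (Φ (suc n)) 0ℤ ≡ 0ℤ
  Φ[0]≡0 = trans (eval-constTerm-divX (Φ (suc n)) 0ℤ) (cong₂ _+_ Φ₀≡0 (ℤP.*-zeroˡ (eval (divX (Φ (suc n))) 0ℤ)))

-- The degree of Φ n

private
  prime-factor : ∀ n → 2 ≤ n → ∃₂ λ p h → Prime p × n ≡ p ℕ.* h
  prime-factor n@(suc _) 2≤n with factorise n
  ... | record { factors = [] ; isFactorisation = eq } = ⊥-elim (ℕP.<-irrefl (sym eq) 2≤n)
  ... | record { factors = p ∷ ps ; isFactorisation = eq ; factorsPrime = prime-p ∷ _ } = p , product ps , prime-p , eq

  prime-∤⇒coprime : ∀ {p c} → Prime p → ¬ p ∣ c → Coprime c p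
  prime-∤⇒coprime prime-p p∤c (i∣c , i∣p) with prime⇒irreducible prime-p i∣p
  ... | inj₁ i≡1  = i≡1
  ... | inj₂ refl = ⊥-elim (p∤c i∣c)

  -- The witness is g = c / p if p ∣ c, and g = c otherwise.
  divisor-of-prime-multiple : ∀ {p h c} → Prime p → 1 ≤ h → ProperDivisor (p ℕ.* h) c → c ≢ h →
                              ∃ λ g → ProperDivisor h g × c ∣ p ℕ.* g
  divisor-of-prime-multiple {p} {h} {c} prime-p 1≤h (c∣ph , 1≤c , c<ph) c≢h with p ∣? c
  ... | yes (divides g refl) = g , (g∣h , 1≤g , g<h) , ND.∣-reflexive (ℕP.*-comm g p)
    where
    instance
      p≢0 : ℕ.NonZero p
      p≢0 = prime⇒nonZero prime-p
    g∣h : g ∣ h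
    g∣h = ND.*-cancelˡ-∣ p (subst (_∣ p ℕ.* h) (ℕP.*-comm g p) c∣ph)
    1≤g : 1 ≤ g
    1≤g = proj₁ (divisor-bounds (ND.n∣m*n p) (subst (1 ≤_) (ℕP.*-comm g p) 1≤c))
    g<h : g < h
    g<h = ℕP.*-cancelˡ-< p g h (subst (_< p ℕ.* h) (ℕP.*-comm g p) c<ph)
  ... | no p∤c = c , ∣-≢⇒ProperDivisor c∣h 1≤h c≢h , ND.n∣m*n p
    where
    c∣h : c ∣ h
    c∣h = coprime-divisor (prime-∤⇒coprime prime-p p∤c) c∣ph

  prime⇒2≤ : ∀ {p} → Prime p → 2 ≤ p
  prime⇒2≤ {p} prime-p = ℕ.nonTrivial⇒n>1 p {{prime⇒nonTrivial prime-p}}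

  positive-gap : ∀ {p m d} → 2 ≤ p → 1 ≤ m → p ℕ.* m ≤ d ℕ.+ m → 1 ≤ d
  positive-gap {d = suc _} _ _ _ = s≤s z≤n
  positive-gap {p} {m@(suc _)} {zero} 2≤p _ pm≤m =
    ⊥-elim (ℕP.<⇒≱ (ℕP.<-≤-trans (ℕP.m<m*n m p 2≤p) (ℕP.≤-reflexive (ℕP.*-comm m p))) pm≤m)

-- Φ h (xᵖ) divides xᵖʰ − 1 and is coprime to every Φ c with c ≠ h a proper divisor of p·h,
-- so it divides Φ (p·h) · Φ h over ℚ; then p·deg Φ h ≤ deg Φ (p·h) + deg Φ h.
Φ-positive-degree-step : ∀ {p h m} → Prime p → 1 ≤ h → 1 ≤ m → Monic (Φ h) m → ∃ λ d → 1 ≤ d × Monic (Φ (p ℕ.* h)) d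
Φ-positive-degree-step {p} {h} {m} prime-p 1≤h 1≤m monic-h = d , 1≤d , monic-N
  where
  instance
    p≢0 : ℕ.NonZero p
    p≢0 = prime⇒nonZero prime-p
  N : ℕ
  N = p ℕ.* h
  1≤N : 1 ≤ N
  1≤N = ℕP.≤-trans 1≤h (ℕP.m≤n*m h p)
  h<N : h < N
  h<N = ℕP.<-≤-trans (ℕP.m<m*n h p {{ℕ.>-nonZero 1≤h}} (prime⇒2≤ prime-p)) (ℕP.≤-reflexive (ℕP.*-comm h p))
  ΦN : IsCyclotomic N
  ΦN = Φ-isCyclotomic 1≤N
  Φh : IsCyclotomic h
  Φh = Φ-isCyclotomic 1≤h
  d : ℕ
  d = IsCyclotomic.degree ΦN
  monic-N : Monic (Φ N) d
  monic-N = IsCyclotomic.monic ΦN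
  f : Poly
  f = compPow p (Φ h)
  f∣xᴺ-1 : f ∣ₑ xnm1 N
  f∣xᴺ-1 = ∣ₑ-resp (eval-compPow-xnm1 p h) (∣ₑ-compPow p (Φ-∣ₑ-xnm1 Φh))
  coprime : ∀ {c} → c ∈ properDivisors N → c ≢ h → Coprimeℚ f (Φ c)
  coprime c∈ c≢h with divisor-of-prime-multiple prime-p 1≤h (∈-properDivisors⁻ {N} c∈) c≢h
  ... | g , g<h@(_ , 1≤g , _) , c∣pg =
    Coprimeℚ-∣ₑ (∣ₑ-trans (Φ-∣ₑ-xnm1 (Φ-isCyclotomic (proj₁ (proj₂ (∈-properDivisors⁻ {N} c∈))))) (xnm1-∣ₑ c∣pg))
      (Coprimeℚ-resp (eval-compPow-xnm1 p g) (Coprimeℚ-compPow p (Φ-coprime-xnm1 Φh (Φ-isCyclotomic 1≤g) g<h)))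
  f∣ΦN·Φh : f ∣ℚ Φ N *P Φ h
  f∣ΦN·Φh = ∣ℚ-cancel-coprime-factors Φ {G = Φ N} (properDivisors N) (properDivisors-unique N)
    (∈-properDivisors⁺ (ND.n∣m*n p , 1≤h , h<N))
    coprime (∣ℚ-resp (λ z → trans (sym (IsCyclotomic.factorisation ΦN z)) (sym (eval-*P (Φ N) (properΦProduct N) z)))
      (∣ₑ⇒∣ℚ f∣xᴺ-1))
  1≤d : 1 ≤ d
  1≤d = positive-gap (prime⇒2≤ prime-p) 1≤m
    (∣ℚ⇒degree-≤ (Leading-compPow p (ℕP.≤-trans (s≤s z≤n) (prime⇒2≤ prime-p)) monic-h) (Leading-*P monic-N monic-h) f∣ΦN·Φh)

Φ-positive-degree : ∀ {n} → 1 ≤ n → ∃ λ m → 1 ≤ m × Monic (Φ n) m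
Φ-positive-degree {n} = <-rec PositiveDegree step n
  where
  PositiveDegree : ℕ → Set
  PositiveDegree n = 1 ≤ n → ∃ λ m → 1 ≤ m × Monic (Φ n) m
  step : ∀ n → (∀ {k} → k < n → PositiveDegree k) → PositiveDegree n
  step (suc zero) _ _ = 1 , ℕP.≤-refl , leading refl (λ ()) λ { (suc zero) (s≤s ()) ; (suc (suc i)) _ → refl }
  step n@(suc (suc _)) below 1≤n with prime-factor n (s≤s (s≤s z≤n))
  ... | p , zero , _ , n≡p*0 with () ← trans n≡p*0 (ℕP.*-zeroʳ p)
  ... | p , h@(suc _) , prime-p , n≡p*h with below h<n (s≤s z≤n)
    where
    h<n : h < n
    h<n = subst (h <_) (sym (trans n≡p*h (ℕP.*-comm p h))) (ℕP.m<m*n h p (prime⇒2≤ prime-p))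
  ...   | m , 1≤m , monic-h = subst PositiveDegree (sym n≡p*h) (λ _ → Φ-positive-degree-step prime-p (s≤s z≤n) 1≤m monic-h) 1≤n

Φ-∤ℚ-one : ∀ {n} → 1 ≤ n → ¬ Φ n ∣ℚ one
Φ-∤ℚ-one 1≤n Φ∣1 with Φ-positive-degree 1≤n
... | m , 1≤m , monic = ℕP.<⇒≱ 1≤m (∣ℚ⇒degree-≤ monic (Leading-const (λ ())) Φ∣1)

Φ-∣ℚ-xnm1⇒∣ : ∀ {n m} → 1 ≤ n → Φ n ∣ℚ xnm1 m → n ∣ m
Φ-∣ℚ-xnm1⇒∣ {n} {m} 1≤n Φ∣xᵐ-1 with Bézout.lemma n m
... | Bézout.result g isGCD identity with g ℕ.≟ n
...   | yes refl = GCD.gcd∣n isGCD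
...   | no g≢n = ⊥-elim (Φ-∤ℚ-one 1≤n (Coprimeℚ-cancel (Φ-coprime-xnm1 Φn (Φ-isCyclotomic 1≤g) g<n) Φ∣xᵍ-1·1))
  where
  Φn : IsCyclotomic n
  Φn = Φ-isCyclotomic 1≤n
  g<n : ProperDivisor n g
  g<n = ∣-≢⇒ProperDivisor (GCD.gcd∣m isGCD) 1≤n g≢n
  1≤g : 1 ≤ g
  1≤g = proj₁ (proj₂ g<n)
  Φ∣xᵍ-1·1 : Φ n ∣ℚ xnm1 g *P one
  Φ∣xᵍ-1·1 with XnCombination-gcd identity
  ... | α , β , eq = ∣ℚ-resp value (∣ℚ-combination (∣ₑ⇒∣ℚ (Φ-∣ₑ-xnm1 Φn)) Φ∣xᵐ-1 α β)
    where
    value : ∀ z → eval (α *P xnm1 n +P β *P xnm1 m) z ≡ eval (xnm1 g *P one) z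
    value z = begin
      eval (α *P xnm1 n +P β *P xnm1 m) z                        ≡⟨ eval-+P (α *P xnm1 n) (β *P xnm1 m) z ⟩
      eval (α *P xnm1 n) z + eval (β *P xnm1 m) z                ≡⟨ cong₂ _+_ (eval-*P α (xnm1 n) z) (eval-*P β (xnm1 m) z) ⟩
      eval α z * eval (xnm1 n) z + eval β z * eval (xnm1 m) z    ≡⟨ eq z ⟩
      eval (xnm1 g) z                                            ≡⟨ sym (eval-*P-one (xnm1 g) z) ⟩
      eval (xnm1 g *P one) z                                     ∎
      where open ≡-Reasoning

-- Even parts and the polynomials U and W

evenPart : Poly → ℤ → ℤ
evenPart p z = eval p z + eval p (- z)

evenPart-+P : ∀ p q z → evenPart (p +P q) z ≡ evenPart p z + evenPart q z
evenPart-+P p q z rewrite eval-+P p q z | eval-+P p q (- z) = lemma (eval p z) (eval q z) (eval p (- z)) (eval q (- z))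
  where lemma : ∀ a b c d → a + b + (c + d) ≡ a + c + (b + d)
        lemma = solve-∀

private
  -‿^-even : ∀ k z → (- z) ^ (2 ℕ.* k) ≡ z ^ (2 ℕ.* k)
  -‿^-even k z = trans (sym (ℤP.^-*-assoc (- z) 2 k)) (trans (cong (_^ k) (lemma z)) (ℤP.^-*-assoc z 2 k))
    where lemma : ∀ z → (- z) * ((- z) * 1ℤ) ≡ z * (z * 1ℤ)
          lemma = solve-∀

evenPart-mono-odd : ∀ c {k} j → k ≡ suc (2 ℕ.* j) → ∀ z → evenPart (mono c k) z ≡ 0ℤ
evenPart-mono-odd c j refl z rewrite eval-mono c (suc (2 ℕ.* j)) z | eval-mono c (suc (2 ℕ.* j)) (- z) | -‿^-even j z =
  lemma c z (z ^ (2 ℕ.* j))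
  where lemma : ∀ c z w → c * (z * w) + c * ((- z) * w) ≡ 0ℤ
        lemma = solve-∀

evenPart-mono-even : ∀ c {k} j → k ≡ 2 ℕ.* j → ∀ z → evenPart (mono c k) z ≡ (c + c) * z ^ (2 ℕ.* j)
evenPart-mono-even c j refl z rewrite eval-mono c (2 ℕ.* j) z | eval-mono c (2 ℕ.* j) (- z) | -‿^-even j z =
  sym (ℤP.*-distribʳ-+ (z ^ (2 ℕ.* j)) c c)

eval-negx-xnm1-even : ∀ {n} → 2 ∣ n → ∀ z → eval (negx (xnm1 n)) z ≡ eval (xnm1 n) z
eval-negx-xnm1-even (divides k refl) z rewrite eval-negx (xnm1 (k ℕ.* 2)) z | eval-xnm1 (k ℕ.* 2) (- z)
  | eval-xnm1 (k ℕ.* 2) z | ℕP.*-comm k 2 | -‿^-even k z = refl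

-- U (s + 2) and W (s + 2) are UW s 1 and UW s (−1) by computation.
UW : ℕ → ℤ → Poly
UW s σ = mono (+ 2) (4 ℕ.* t ∸ 1) +P mono σ (2 ℕ.* t ℕ.+ 4) +P mono (- + 2) (2 ℕ.* t ℕ.+ 1)
      +P mono (+ 2) (2 ℕ.* t ∸ 1) +P mono (- σ) (2 ℕ.* t ∸ 4) +P mono (- + 2) 1
  where
  t : ℕ
  t = suc (suc s)

private
  exp₁ : ∀ s → 4 ℕ.* (2 ℕ.+ s) ≡ 2 ℕ.+ 2 ℕ.* (2 ℕ.* s ℕ.+ 3)
  exp₁ = ℕ-Solver.solve-∀
  exp₂ : ∀ s → 2 ℕ.* (2 ℕ.+ s) ℕ.+ 4 ≡ 2 ℕ.* (s ℕ.+ 4)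
  exp₂ = ℕ-Solver.solve-∀
  exp₃ : ∀ s → 2 ℕ.* (2 ℕ.+ s) ℕ.+ 1 ≡ 1 ℕ.+ 2 ℕ.* (s ℕ.+ 2)
  exp₃ = ℕ-Solver.solve-∀
  exp₄ : ∀ s → 2 ℕ.* (2 ℕ.+ s) ≡ 2 ℕ.+ 2 ℕ.* (s ℕ.+ 1)
  exp₄ = ℕ-Solver.solve-∀
  exp₅ : ∀ s → 2 ℕ.* (2 ℕ.+ s) ≡ 4 ℕ.+ 2 ℕ.* s
  exp₅ = ℕ-Solver.solve-∀
  exp₆ : ∀ s → 2 ℕ.* (s ℕ.+ 4) ≡ 2 ℕ.* s ℕ.+ 8
  exp₆ = ℕ-Solver.solve-∀

module _ (s : ℕ) (σ : ℤ) where
  private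
    t : ℕ
    t = suc (suc s)
    m₁ m₂ m₃ m₄ m₅ m₆ : Poly
    m₁ = mono (+ 2) (4 ℕ.* t ∸ 1)
    m₂ = mono σ (2 ℕ.* t ℕ.+ 4)
    m₃ = mono (- + 2) (2 ℕ.* t ℕ.+ 1)
    m₄ = mono (+ 2) (2 ℕ.* t ∸ 1)
    m₅ = mono (- σ) (2 ℕ.* t ∸ 4)
    m₆ = mono (- + 2) 1

  -- Only the two even-degree terms σ·x^(2t+4) and −σ·x^(2t−4) survive in U(x) + U(−x).
  evenPart-UW : ∀ z → evenPart (UW s σ) z ≡ (σ + σ) * eval (mono 1ℤ (2 ℕ.* s) *P xnm1 8) z
  evenPart-UW z
    rewrite evenPart-+P (m₁ +P m₂ +P m₃ +P m₄ +P m₅) m₆ z | evenPart-+P (m₁ +P m₂ +P m₃ +P m₄) m₅ z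
          | evenPart-+P (m₁ +P m₂ +P m₃) m₄ z | evenPart-+P (m₁ +P m₂) m₃ z | evenPart-+P m₁ m₂ z
          | evenPart-mono-odd (+ 2) (2 ℕ.* s ℕ.+ 3) (cong (_∸ 1) (exp₁ s)) z
          | evenPart-mono-even σ (s ℕ.+ 4) (exp₂ s) z
          | evenPart-mono-odd (- + 2) (s ℕ.+ 2) (exp₃ s) z
          | evenPart-mono-odd (+ 2) (s ℕ.+ 1) (cong (_∸ 1) (exp₄ s)) z
          | evenPart-mono-even (- σ) s (cong (_∸ 4) (exp₅ s)) z
          | evenPart-mono-odd (- + 2) 0 refl z
          | eval-*P (mono 1ℤ (2 ℕ.* s)) (xnm1 8) z | eval-mono 1ℤ (2 ℕ.* s) z | eval-xnm1 8 z
          | cong (z ^_) (exp₆ s) | ℤP.^-distribˡ-+-* z (2 ℕ.* s) 8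
    = lemma σ (z ^ (2 ℕ.* s)) (z ^ 8)
    where lemma : ∀ σ w v → 0ℤ + (σ + σ) * (w * v) + 0ℤ + 0ℤ + (- σ + - σ) * w + 0ℤ ≡ (σ + σ) * (1ℤ * w * (v - 1ℤ))
          lemma = solve-∀

private
  4∣⇒2∣ : ∀ {b} → 4 ∣ b → 2 ∣ b
  4∣⇒2∣ = ND.∣-trans (divides 2 refl)

  even-proper-multiple : ∀ {b c} → 4 ∣ b → ProperDivisor b c → ∃ λ k → c ∣ 2 ℕ.* k × ProperDivisor b (2 ℕ.* k)
  even-proper-multiple {b} {c} 4∣b c-proper@(divides r b≡rc , 1≤c , c<b) with 2 ∣? c
  ... | yes (divides k refl) = k , ND.∣-reflexive (ℕP.*-comm k 2) , subst (ProperDivisor b) (ℕP.*-comm k 2) c-proper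
  ... | no 2∤c = c , ND.n∣m*n 2 , ∣-≢⇒ProperDivisor 2c∣b (ℕP.≤-trans 1≤c (ℕP.<⇒≤ c<b)) 2c≢b
    where
    2c∣b : 2 ℕ.* c ∣ b
    2c∣b with euclidsLemma r c prime[2] (subst (2 ∣_) b≡rc (4∣⇒2∣ 4∣b))
    ... | inj₂ 2∣c = ⊥-elim (2∤c 2∣c)
    ... | inj₁ (divides r′ refl) = divides r′ (trans b≡rc (ℕP.*-assoc r′ 2 c))
    2c≢b : 2 ℕ.* c ≢ b
    2c≢b refl = 2∤c (ND.*-cancelˡ-∣ 2 4∣b)

  Φ-coprime-negx-Φ : ∀ {b c} → 4 ∣ b → IsCyclotomic b → ProperDivisor b c → Coprimeℚ (Φ b) (negx (Φ c))
  Φ-coprime-negx-Φ 4∣b Φb c<b@(_ , 1≤c , _) with even-proper-multiple 4∣b c<b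
  ... | k , c∣2k , 2k<b@(_ , 1≤2k , _) =
    Coprimeℚ-∣ₑ (∣ₑ-resp (eval-negx-xnm1-even (ND.m∣m*n k))
                         (∣ₑ-negx (∣ₑ-trans (Φ-∣ₑ-xnm1 (Φ-isCyclotomic 1≤c)) (xnm1-∣ₑ c∣2k))))
      (Φ-coprime-xnm1 Φb (Φ-isCyclotomic 1≤2k) 2k<b)

Φ-∣ℚ-negx : ∀ {b} → 4 ∣ b → 1 ≤ b → Φ b ∣ℚ negx (Φ b)
Φ-∣ℚ-negx {b} 4∣b 1≤b = Coprimeℚ-cancel coprime (∣ₑ⇒∣ℚ (∣ₑ-resp factor (Φ-∣ₑ-xnm1 Φb)))
  where
  Φb : IsCyclotomic b
  Φb = Φ-isCyclotomic 1≤b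
  coprime : Coprimeℚ (Φ b) (negx (properΦProduct b))
  coprime = Coprimeℚ-resp (λ z → sym (eval-negx-prodP (map Φ (properDivisors b)) z))
    (Coprimeℚ-prodP (map negx (map Φ (properDivisors b)))
      (AllP.map⁺ (AllP.map⁺ (All.tabulate λ c∈ → Φ-coprime-negx-Φ 4∣b Φb (∈-properDivisors⁻ c∈)))))
  factor : ∀ z → eval (xnm1 b) z ≡ eval (negx (properΦProduct b) *P negx (Φ b)) z
  factor z = begin
    eval (xnm1 b) z                                          ≡⟨ sym (eval-negx-xnm1-even (4∣⇒2∣ 4∣b) z) ⟩
    eval (negx (xnm1 b)) z                                   ≡⟨ eval-negx (xnm1 b) z ⟩
    eval (xnm1 b) (- z)                                      ≡⟨ sym (IsCyclotomic.factorisation Φb (- z)) ⟩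
    eval (Φ b) (- z) * eval (properΦProduct b) (- z)         ≡⟨ ℤP.*-comm (eval (Φ b) (- z)) _ ⟩
    eval (properΦProduct b) (- z) * eval (Φ b) (- z)         ≡⟨ sym (cong₂ _*_ (eval-negx (properΦProduct b) z) (eval-negx (Φ b) z)) ⟩
    eval (negx (properΦProduct b)) z * eval (negx (Φ b)) z   ≡⟨ sym (eval-*P (negx (properΦProduct b)) (negx (Φ b)) z) ⟩
    eval (negx (properΦProduct b) *P negx (Φ b)) z           ∎
    where open ≡-Reasoning

Φ-∣ℚ-evenPart-factor : ∀ {b V P} σ j → 4 ∣ b → 1 ≤ b → σ ≢ 0ℤ →
  (∀ z → evenPart V z ≡ σ * eval (mono 1ℤ j *P P) z) → Φ b ∣ₑ V → Φ b ∣ℚ P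
Φ-∣ℚ-evenPart-factor {b} {V} {P} σ j 4∣b 1≤b σ≢0 evenPart-V Φ∣V =
  Coprimeℚ-cancel (Coprimeℚ-x^ (Φ-constTerm≢0 1≤b) j)
    (∣ℚ-unscale σ≢0 (∣ℚ-resp value (∣ℚ-combination (∣ₑ⇒∣ℚ Φ∣V) Φ∣negxV one one)))
  where
  Φ∣negxV : Φ b ∣ℚ negx V
  Φ∣negxV = ∣ℚ-∣ₑ-trans (Φ-∣ℚ-negx 4∣b 1≤b) (∣ₑ-negx Φ∣V)
  value : ∀ z → eval (one *P V +P one *P negx V) z ≡ eval (scaleP σ (mono 1ℤ j *P P)) z
  value z = begin
    eval (one *P V +P one *P negx V) z                  ≡⟨ eval-+P (one *P V) (one *P negx V) z ⟩
    eval (one *P V) z + eval (one *P negx V) z          ≡⟨ cong₂ _+_ (eval-one-*P V z) (trans (eval-one-*P (negx V) z) (eval-negx V z)) ⟩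
    evenPart V z                                        ≡⟨ evenPart-V z ⟩
    σ * eval (mono 1ℤ j *P P) z                         ≡⟨ sym (eval-scaleP σ (mono 1ℤ j *P P) z) ⟩
    eval (scaleP σ (mono 1ℤ j *P P)) z                  ∎
    where open ≡-Reasoning

private
  4∣∧∣8⇒4or8 : ∀ {b} → 1 ≤ b → 4 ∣ b → b ∣ 8 → b ≡ 4 ⊎ b ≡ 8
  4∣∧∣8⇒4or8 ()  (divides zero refl)                _
  4∣∧∣8⇒4or8 _   (divides 1 refl)                   _   = inj₁ refl
  4∣∧∣8⇒4or8 _   (divides 2 refl)                   _   = inj₂ refl
  4∣∧∣8⇒4or8 _   (divides (suc (suc (suc k))) refl) b∣8 = ⊥-elim (ℕP.<⇒≱ (ℕP.m≤m+n 9 (3 ℕ.+ k ℕ.* 4)) (ND.∣⇒≤ b∣8))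

lemma15 : (t : ℕ) → 2 ≤ t → (b : ℕ) → 1 ≤ b → 4 ∣ b →
          (Φ b ∣P U t ⊎ Φ b ∣P W t) → b ≡ 4 ⊎ b ≡ 8
lemma15 (suc zero)    (s≤s ()) _ _ _ _
lemma15 (suc (suc s)) _ b 1≤b 4∣b Φ∣U⊎W = 4∣∧∣8⇒4or8 1≤b 4∣b (Φ-∣ℚ-xnm1⇒∣ 1≤b (Φ∣x⁸-1 Φ∣U⊎W))
  where
  Φ∣x⁸-1 : Φ b ∣P U (suc (suc s)) ⊎ Φ b ∣P W (suc (suc s)) → Φ b ∣ℚ xnm1 8
  Φ∣x⁸-1 (inj₁ Φ∣U) = Φ-∣ℚ-evenPart-factor (+ 2) (2 ℕ.* s) 4∣b 1≤b (λ ())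
                         (evenPart-UW s (+ 1)) (∣P⇒∣ₑ (U (suc (suc s))) Φ∣U)
  Φ∣x⁸-1 (inj₂ Φ∣W) = Φ-∣ℚ-evenPart-factor (- + 2) (2 ℕ.* s) 4∣b 1≤b (λ ())
                         (evenPart-UW s (- + 1)) (∣P⇒∣ₑ (W (suc (suc s))) Φ∣W)
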